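{- For every integer $k\ge 0$, there exists a bijection between $\mathcal{U}_{2k+1}(231,312)$ and $\mathcal{D}_k$, the set of Dyck paths of semilength $k$. In particular, $|\mathcal{U}_{2k+1}(231,312)|=\frac{1}{k+1}\binom{2k}{k}$.
   Context: West's stack-sorting map $s$ is defined recursively on finite sequences of distinct positive integers: $s$ sends the empty sequence to itself, and if $\pi$ is a nonempty such sequence with largest entry $n$, writing $\pi=LnR$ one sets $s(\pi)=s(L)s(R)n$. A permutation $\pi\in S_n$ (one-line notation) is uniquely sorted if exactly one permutation $\sigma\in S_n$ satisfies $s(\sigma)=\pi$. Let $\mathcal{U}_n$ be the set of uniquely sorted permutations in $S_n$. A permutation $\pi$ contains a pattern $\tau\in S_m$ if some subsequence of $\pi$ of length $m$ has its entries in the same relative order as $\tau$; otherwise $\pi$ avoids $\tau$. $\mathcal{U}_{n}(\tau^{(1)},\dots,\tau^{(\ell)})$ denotes the set of permutations in $\mathcal{U}_n$ avoiding all of $\tau^{(1)},\dots,\tau^{(\ell)}$. A Dyck path of semilength $k$ is a lattice path from $(0,0)$ to $(2k,0)$ with $k$ steps $(1,1)$ and $k$ steps $(1,-1)$ never going below the horizontal axis. -}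

module Defs where

open import Data.Nat using (ℕ; zero; suc; _+_; _*_; _<_; _/_; _≟_)
open import Data.Nat.Combinatorics using (_C_)
open import Data.List using (List; []; _∷_; _++_; length; foldr; applyUpTo; break)
open import Data.Nat using (_⊔_)
open import Data.List.Relation.Binary.Permutation.Propositional using (_↭_)
open import Data.List.Relation.Binary.Sublist.Propositional using (_⊆_)
open import Data.Fin using (Fin; cast)
open import Data.Product using (Σ; _×_; _,_; proj₁; ∃)
open import Data.Maybe using (Maybe; just; nothing)
open import Function.Bundles using (_⇔_; Bijection)
open import Relation.Binary.Bundles using (Setoid)
open import Relation.Binary.PropositionalEquality using (_≡_)
import Relation.Binary.PropositionalEquality as ≡
import Relation.Binary.Construct.On as On
import Data.List as L

-- West's stack-sorting map, exactly as the recursive definition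
--   s([]) = [],  s(L n R) = s(L) s(R) n   (n the largest entry).
-- The recursion is structural on a fuel parameter; `s` supplies
-- fuel = length of the input, which always suffices (L, R are shorter).

maxList : List ℕ → ℕ
maxList = foldr _⊔_ 0

sFuel : ℕ → List ℕ → List ℕ
sFuel zero    π = []
sFuel (suc f) [] = []
sFuel (suc f) π@(_ ∷ _) with break (_≟ maxList π) π
... | (Lπ , [])        = []   -- unreachable: the maximum occurs in π
... | (Lπ , n ∷ Rπ)    = sFuel f Lπ ++ sFuel f Rπ ++ (n ∷ [])

s : List ℕ → List ℕ
s π = sFuel (length π) π

-- Permutations of [n] = {1,…,n} in one-line notation.

IsPerm : ℕ → List ℕ → Set
IsPerm n σ = σ ↭ applyUpTo suc n

UniquelySorted : ℕ → List ℕ → Set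
UniquelySorted n π =
  Σ (List ℕ) λ σ → IsPerm n σ × s σ ≡ π ×
    ((τ : List ℕ) → IsPerm n τ → s τ ≡ π → τ ≡ σ)

SameRelOrder : List ℕ → List ℕ → Set
SameRelOrder ρ τ =
  Σ (length ρ ≡ length τ) λ eq →
    (i j : Fin (length ρ)) →
      (L.lookup ρ i < L.lookup ρ j) ⇔ (L.lookup τ (cast eq i) < L.lookup τ (cast eq j))

Contains : List ℕ → List ℕ → Set
Contains π τ = Σ (List ℕ) λ ρ → ρ ⊆ π × SameRelOrder ρ τ

Avoids : List ℕ → List ℕ → Set
Avoids π τ = Contains π τ → Data.Empty.⊥
  where import Data.Empty

U231-312 : ℕ → List ℕ → Set
U231-312 n π = IsPerm n π × UniquelySorted n π ×
               Avoids π (2 ∷ 3 ∷ 1 ∷ []) × Avoids π (3 ∷ 1 ∷ 2 ∷ [])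

-- Dyck paths: words in U = (1,1), D = (1,-1).

data Step : Set where
  U D : Step

walk : ℕ → List Step → Maybe ℕ
walk h []             = just h
walk h (U ∷ p)        = walk (suc h) p
walk zero (D ∷ p)     = nothing
walk (suc h) (D ∷ p)  = walk h p

IsDyck : ℕ → List Step → Set
IsDyck k p = length p ≡ 2 * k × walk 0 p ≡ just 0

-- The sets as setoids (two elements equal iff the underlying words are
-- equal; membership proofs are ignored).

𝒰-setoid : ℕ → Setoid _ _
𝒰-setoid n = On.setoid (≡.setoid (List ℕ)) (proj₁ {B = U231-312 n})

𝒟-setoid : ℕ → Setoid _ _
𝒟-setoid k = On.setoid (≡.setoid (List Step)) (proj₁ {B = IsDyck k})

Fin-setoid : ℕ → Setoid _ _
Fin-setoid m = ≡.setoid (Fin m)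

catalan : ℕ → ℕ
catalan k = ((2 * k) C k) / suc k

module Submission where

-- The bridge is the descent word of a list: U at each descent, D at each
-- ascent.  Such a word is also read from right to left with D an up-step and
-- U a down-step (its back-walk); the descent word is a Dyck path iff this
-- back-walk ends at height 0.
--  * Sorting.  Every list has a decreasing binary tree: its maximum n splits
--    it as L n R, and s(L n R) = s(L) s(R) n.  By induction on the tree the
--    back-walk of s(σ) never fails.  If it ends at height 0, σ is the only
--    preimage of s(σ) (sorted-unique); otherwise a second preimage exists
--    (another-preimage).  So a uniquely sorted permutation has a Dyck
--    descent word.
--  * Avoiding 231 and 312 means that every subsequence a b c with c < a has
--    c < b < a ("sandwiched").  A sandwiched list of distinct entries with a
--    Dyck descent word has a preimage under s (sorted-preimage); a sandwiched
--    permutation is determined by its descent word (descents-injective); and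
--    every Dyck path is the descent word of a layered permutation.
--  * Hence π ↦ descents π is a bijection onto Dyck paths.  Dyck paths are
--    ranked onto Fin of a ballot number, which a reflection identity shows
--    to be the Catalan number C(2k,k)/(k+1).

open import Defs
open import Data.Bool using (true; false; T)
open import Data.Empty using (⊥; ⊥-elim)
open import Data.Fin using (Fin; cast; splitAt; _↑ˡ_; _↑ʳ_; join) renaming (zero to #0; suc to fsuc)
open import Data.Fin.Properties using (splitAt-↑ˡ; splitAt-↑ʳ; join-splitAt)
open import Data.List using (List; []; _∷_; _++_; [_]; length; head; lookup; break; replicate; applyUpTo; initLast; _∷ʳ′_)
open import Data.List.Properties using (length-++; takeWhile++dropWhile; span-defn; ++-assoc; ++-identityʳ; ++-cancelˡ; ++-cancelʳ; ∷-injective; ∷-injectiveˡ; ∷-injectiveʳ; ∷ʳ-injective; applyUpTo-∷ʳ; length-applyUpTo)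
open import Data.List.Membership.Propositional using (_∈_; _∉_)
open import Data.List.Membership.Propositional.Properties using (∈-insert; ∈-++⁺ˡ; ∈-++⁻; ∈-∃++; ∈-applyUpTo⁺; ∈-applyUpTo⁻)
open import Data.List.Relation.Binary.Permutation.Propositional using (_↭_; ↭-refl; ↭-reflexive; ↭-sym; ↭-trans; prep; ↭⇒↭ₛ)
open import Data.List.Relation.Binary.Permutation.Propositional.Properties using (++⁺; ++⁺ˡ; ++⁺ʳ; ∷↭∷ʳ; shift; drop-mid; ↭-empty-inv; ↭-length; ∈-resp-↭; All-resp-↭)
import Data.List.Relation.Binary.Permutation.Setoid.Properties as PermutationSetoid
open import Data.List.Relation.Binary.Sublist.Propositional using (_⊆_; []; _∷_; _∷ʳ_; ⊆-refl; ⊆-trans; from∈) renaming (lookup to ∈-resp-⊆)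
import Data.List.Relation.Binary.Sublist.Propositional.Properties as Sublist
open import Data.List.Relation.Unary.All as All using (All; []; _∷_)
import Data.List.Relation.Unary.All.Properties as All
open import Data.List.Relation.Unary.AllPairs using (AllPairs; []; _∷_)
open import Data.List.Relation.Unary.Any using (here; there)
open import Data.List.Relation.Unary.Unique.Propositional using (Unique)
open import Data.List.Relation.Unary.Unique.Propositional.Properties using (Unique[x∷xs]⇒x∉xs; applyUpTo⁺₁)
open import Data.Maybe using (Maybe; just; nothing; _>>=_)
open import Data.Maybe.Properties using (just-injective)
open import Data.Nat using (ℕ; zero; suc; _+_; _*_; _∸_; _/_; _≤_; _<_; _≟_; _<?_; _⊔_; _≡ᵇ_; z≤n; s≤s)
open import Data.Nat.Combinatorics using (_C_; nCk+nC[k+1]≡[n+1]C[k+1]; nCk≡nC[n∸k])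
open import Data.Nat.Combinatorics.Specification using (k>n⇒nCk≡0)
open import Data.Nat.DivMod using (m*n/n≡m)
open import Data.Nat.Properties
open import Data.Nat.Solver using (module +-*-Solver)
open import Data.Product using (Σ; ∃; ∃₂; _×_; _,_; proj₁; proj₂; uncurry)
open import Data.Sum using (_⊎_; inj₁; inj₂)
open import Data.Unit using (⊤; tt)
open import Function using (_∘_; _$_)
open import Function.Bundles using (Bijection; _⇔_; mk⇔; Equivalence)
open import Function.Construct.Composition using (bijection)
open import Relation.Binary.Definitions using (tri<; tri≈; tri>)
open import Relation.Binary.PropositionalEquality using (_≡_; _≢_; refl; sym; trans; cong; cong₂; subst; setoid; module ≡-Reasoning)
open import Relation.Nullary using (¬_; yes; no; ¬?; contradiction)
open import Relation.Unary using (Decidable)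

open +-*-Solver using (solve; _:=_; con; _:+_; _:*_)

length-++-∷ : ∀ (L : List ℕ) n R → length (L ++ n ∷ R) ≡ suc (length L + length R)
length-++-∷ L n R = trans (length-++ L) (+-suc (length L) (length R))

parts-shorter : ∀ (L : List ℕ) n R {m} → length (L ++ n ∷ R) ≤ suc m → length L ≤ m × length R ≤ m
parts-shorter L n R le with ≤-trans (≤-reflexive (sym (length-++-∷ L n R))) le
... | s≤s le′ = ≤-trans (m≤m+n _ _) le′ , ≤-trans (m≤n+m _ _) le′

All-removeMiddle : ∀ {P : ℕ → Set} L {n R} → All P (L ++ n ∷ R) → All P (L ++ R)
All-removeMiddle L ps with All.++⁻ʳ L ps
... | _ ∷ psR = All.++⁺ (All.++⁻ˡ L ps) psR

All-insertMiddle : ∀ {P : ℕ → Set} L {n R} → P n → All P (L ++ R) → All P (L ++ n ∷ R)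
All-insertMiddle L pn ps = All.++⁺ (All.++⁻ˡ L ps) (pn ∷ All.++⁻ʳ L ps)

maxList-≥ : ∀ {x} xs → x ∈ xs → x ≤ maxList xs
maxList-≥ (y ∷ ys) (here refl) = m≤m⊔n y (maxList ys)
maxList-≥ (y ∷ ys) (there p)   = ≤-trans (maxList-≥ ys p) (m≤n⊔m y (maxList ys))

maxList-lub : ∀ {m} xs → All (_≤ m) xs → maxList xs ≤ m
maxList-lub []       []       = z≤n
maxList-lub (x ∷ xs) (p ∷ ps) = ⊔-lub p (maxList-lub xs ps)

maxList-∈ : ∀ x xs → maxList (x ∷ xs) ∈ x ∷ xs
maxList-∈ x []       = here (⊔-identityʳ x)
maxList-∈ x (y ∷ ys) with ⊔-sel x (maxList (y ∷ ys))
... | inj₁ eq = here eq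
... | inj₂ eq = there (subst (_∈ y ∷ ys) (sym eq) (maxList-∈ y ys))

maxList-≡ : ∀ {n} xs → n ∈ xs → All (_≤ n) xs → maxList xs ≡ n
maxList-≡ xs n∈xs bnd = ≤-antisym (maxList-lub xs bnd) (maxList-≥ xs n∈xs)

firstOccurrence : ∀ {m} xs → m ∈ xs → ∃₂ λ L R → xs ≡ L ++ m ∷ R × m ∉ L
firstOccurrence {m} (x ∷ xs) m∈ with x ≟ m | m∈
... | yes refl | _           = [] , xs , refl , λ ()
... | no x≢m   | here m≡x    = contradiction (sym m≡x) x≢m
... | no x≢m   | there m∈xs with firstOccurrence xs m∈xs
...   | L , R , refl , m∉L = x ∷ L , R , refl , λ { (here m≡x) → x≢m (sym m≡x) ; (there p) → m∉L p }

-- The definition of s splits with `break (_≟ m)`, which computes through the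
-- boolean test _≡ᵇ_; these two facts let that computation proceed.
≡ᵇ-refl : ∀ m → (m ≡ᵇ m) ≡ true
≡ᵇ-refl zero    = refl
≡ᵇ-refl (suc m) = ≡ᵇ-refl m

≢⇒≡ᵇ-false : ∀ {x m} → x ≢ m → (x ≡ᵇ m) ≡ false
≢⇒≡ᵇ-false {x} {m} x≢m with x ≡ᵇ m in eq
... | true  = contradiction (≡ᵇ⇒≡ x m (subst T (sym eq) tt)) x≢m
... | false = refl

break-++ : ∀ m xs → proj₁ (break (_≟ m) xs) ++ proj₂ (break (_≟ m) xs) ≡ xs
break-++ m xs = trans (cong (uncurry _++_) (span-defn P? xs)) (takeWhile++dropWhile P? xs)
  where
  P? : Decidable (λ x → ¬ x ≡ m)
  P? = ¬? ∘ (_≟ m)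

break-first : ∀ m L R → m ∉ L → break (_≟ m) (L ++ m ∷ R) ≡ (L , m ∷ R)
break-first m []      R _ rewrite ≡ᵇ-refl m = refl
break-first m (x ∷ L) R m∉L
  rewrite ≢⇒≡ᵇ-false (λ x≡m → m∉L (here (sym x≡m)))
        | break-first m L R (m∉L ∘ there) = refl

sFuel-stable : ∀ f g π → length π ≤ f → length π ≤ g → sFuel f π ≡ sFuel g π
sFuel-stable zero    zero    []      _ _ = refl
sFuel-stable zero    (suc g) []      _ _ = refl
sFuel-stable (suc f) zero    []      _ _ = refl
sFuel-stable (suc f) (suc g) []      _ _ = refl
sFuel-stable (suc f) (suc g) (x ∷ xs) lf lg
  with break (_≟ maxList (x ∷ xs)) (x ∷ xs) | break-++ (maxList (x ∷ xs)) (x ∷ xs)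
... | L , []     | _  = refl
... | L , n ∷ R | split-eq =
  cong₂ (λ l r → l ++ r ++ [ n ])
    (sFuel-stable f g L (proj₁ (parts-shorter L n R lf′)) (proj₁ (parts-shorter L n R lg′)))
    (sFuel-stable f g R (proj₂ (parts-shorter L n R lf′)) (proj₂ (parts-shorter L n R lg′)))
  where
  lf′ : length (L ++ n ∷ R) ≤ suc f
  lg′ : length (L ++ n ∷ R) ≤ suc g
  lf′ = subst (λ π → length π ≤ suc f) (sym split-eq) lf
  lg′ = subst (λ π → length π ≤ suc g) (sym split-eq) lg

s-cons : ∀ π {L n R} → break (_≟ maxList π) π ≡ (L , n ∷ R) → s π ≡ s L ++ s R ++ [ n ]
s-cons [] ()
s-cons (x ∷ xs) eq
  with break (_≟ maxList (x ∷ xs)) (x ∷ xs) | break-++ (maxList (x ∷ xs)) (x ∷ xs) | eq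
... | L , n ∷ R | split-eq | refl =
  cong₂ (λ l r → l ++ r ++ [ n ])
    (sFuel-stable (length xs) (length L) L (proj₁ shorter) ≤-refl)
    (sFuel-stable (length xs) (length R) R (proj₂ shorter) ≤-refl)
  where
  shorter : length L ≤ length xs × length R ≤ length xs
  shorter = parts-shorter L n R (≤-reflexive (cong length split-eq))

s-unfold : ∀ L n R → n ∉ L → All (_≤ n) (L ++ R) → s (L ++ n ∷ R) ≡ s L ++ s R ++ [ n ]
s-unfold L n R n∉L bnd = s-cons (L ++ n ∷ R) (trans (cong (λ m → break (_≟ m) π) max≡n) (break-first n L R n∉L))
  where
  π : List ℕ
  π = L ++ n ∷ R
  max≡n : maxList π ≡ n
  max≡n = maxList-≡ π (∈-insert L) (All-insertMiddle L ≤-refl bnd)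

-- The decreasing binary tree of a list: split at the first occurrence of the
-- maximum and recurse on both sides.  Structural recursion on this tree is
-- recursion along the definition of s.
data DecTree : List ℕ → Set where
  leaf : DecTree []
  node : ∀ {L R} n → n ∉ L → All (_≤ n) (L ++ R) → DecTree L → DecTree R → DecTree (L ++ n ∷ R)

decTree′ : ∀ f π → length π ≤ f → DecTree π
decTree′ _       []       _  = leaf
decTree′ (suc f) (x ∷ xs) le with firstOccurrence (x ∷ xs) (maxList-∈ x xs)
... | L , R , split-eq , m∉L =
  subst DecTree (sym split-eq)
    (node m m∉L (All-removeMiddle L bnd)
      (decTree′ f L (proj₁ shorter)) (decTree′ f R (proj₂ shorter)))
  where
  m : ℕ
  m = maxList (x ∷ xs)
  bnd : All (_≤ m) (L ++ m ∷ R)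
  bnd = subst (All (_≤ m)) split-eq (All.tabulate (maxList-≥ (x ∷ xs)))
  shorter : length L ≤ f × length R ≤ f
  shorter = parts-shorter L m R (subst (λ π → length π ≤ suc f) split-eq le)

decTree : ∀ π → DecTree π
decTree π = decTree′ (length π) π ≤-refl

s-↭ : ∀ {π} → DecTree π → s π ↭ π
s-↭ leaf = ↭-refl
s-↭ (node {L} {R} n n∉L bnd tL tR) rewrite s-unfold L n R n∉L bnd =
  ++⁺ (s-↭ tL) (↭-trans (++⁺ʳ [ n ] (s-↭ tR)) (↭-sym (∷↭∷ʳ n R)))

s-empty : ∀ {π} → DecTree π → s π ≡ [] → π ≡ []
s-empty {[]}    _ _  = refl
s-empty {_ ∷ _} t eq = contradiction (trans (sym (↭-length (s-↭ t))) (cong length eq)) λ ()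

sorted-nonempty : ∀ {X b B} → s X ≡ b ∷ B → X ≢ []
sorted-nonempty {[]}    () _
sorted-nonempty {_ ∷ _} _  ()

step : ℕ → ℕ → Step
step x y with y <? x
... | yes _ = U
... | no  _ = D

step-U : ∀ {x y} → y < x → step x y ≡ U
step-U {x} {y} y<x with y <? x
... | yes _   = refl
... | no  y≮x = contradiction y<x y≮x

step-D : ∀ {x y} → x ≤ y → step x y ≡ D
step-D {x} {y} x≤y with y <? x
... | yes y<x = contradiction x≤y (<⇒≱ y<x)
... | no  _   = refl

step-D⁻ : ∀ {x y} → step x y ≡ D → x ≤ y
step-D⁻ {x} {y} eq with y <? x
step-D⁻ {x} {y} () | yes _
... | no y≮x = ≮⇒≥ y≮x

descentsFrom : ℕ → List ℕ → List Step
descentsFrom x []       = []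
descentsFrom x (y ∷ ys) = step x y ∷ descentsFrom y ys

descents : List ℕ → List Step
descents []       = []
descents (x ∷ xs) = descentsFrom x xs

lastOf : ℕ → List ℕ → ℕ
lastOf x []       = x
lastOf x (y ∷ ys) = lastOf y ys

lastOf-∈ : ∀ x xs → lastOf x xs ∈ x ∷ xs
lastOf-∈ x []       = here refl
lastOf-∈ x (y ∷ ys) = there (lastOf-∈ y ys)

lastOf-++ : ∀ x ys z zs → lastOf x (ys ++ z ∷ zs) ≡ lastOf z zs
lastOf-++ x []       z zs = refl
lastOf-++ x (y ∷ ys) z zs = lastOf-++ y ys z zs

lastOf-snoc : ∀ a A Z n → a ∷ A ≡ Z ++ [ n ] → lastOf a A ≡ n
lastOf-snoc a A []      n eq with refl , refl ← ∷-injective eq = refl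
lastOf-snoc a A (z ∷ Z) n eq with refl , refl ← ∷-injective eq = lastOf-++ a Z n []

descentsFrom-++ : ∀ x ys z zs →
  descentsFrom x (ys ++ z ∷ zs) ≡ descentsFrom x ys ++ step (lastOf x ys) z ∷ descentsFrom z zs
descentsFrom-++ x []       z zs = refl
descentsFrom-++ x (y ∷ ys) z zs = cong (step x y ∷_) (descentsFrom-++ y ys z zs)

length-descentsFrom : ∀ x xs → length (descentsFrom x xs) ≡ length xs
length-descentsFrom x []       = refl
length-descentsFrom x (y ∷ ys) = cong suc (length-descentsFrom y ys)

stepBack : Step → ℕ → Maybe ℕ
stepBack D h       = just (suc h)
stepBack U zero    = nothing
stepBack U (suc h) = just h

-- The back-walk from height h: the word is read from its last letter to its
-- first; nothing if it would go below 0.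
walkBack : ℕ → List Step → Maybe ℕ
walkBack h []      = just h
walkBack h (x ∷ w) = walkBack h w >>= stepBack x

walkBack-++ : ∀ h u v → walkBack h (u ++ v) ≡ (walkBack h v >>= λ g → walkBack g u)
walkBack-++ h []      v with walkBack h v
... | nothing = refl
... | just _  = refl
walkBack-++ h (x ∷ u) v rewrite walkBack-++ h u v with walkBack h v
... | nothing = refl
... | just _  = refl

walkBack-shift : ∀ h w {g} c → walkBack h w ≡ just g → walkBack (h + c) w ≡ just (g + c)
walkBack-shift h []      c refl = refl
walkBack-shift h (x ∷ w) c eq with walkBack h w in eqw
... | just g′ rewrite walkBack-shift h w c eqw = shifted x g′ eq
  where
  shifted : ∀ x g′ {g} → stepBack x g′ ≡ just g → stepBack x (g′ + c) ≡ just (g + c)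
  shifted D g′       refl = refl
  shifted U (suc g′) refl = refl

walkBack-snoc-D : ∀ w → walkBack 0 (w ++ [ D ]) ≡ walkBack 1 w
walkBack-snoc-D w = walkBack-++ 0 w [ D ]

-- BackHeight π h: the back-walk of the descent word of π ends at height h.
-- π has a Dyck descent word iff BackHeight π 0.
BackHeight : List ℕ → ℕ → Set
BackHeight π h = walkBack 0 (descents π) ≡ just h

backHeight-functional : ∀ π {h h′} → BackHeight π h → BackHeight π h′ → h ≡ h′
backHeight-functional _ eq eq′ = just-injective (trans (sym eq) eq′)

-- The back-height after the junction step j from A into B, when B ++ [ n ]
-- has back-height h + 1.
afterJunction : Step → ℕ → ℕ
afterJunction U h = h
afterJunction D h = suc (suc h)

-- The back-height of A ++ B ++ [ n ] when n is above every entry of A and B,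
-- in terms of the back-heights of A and B.
joinHeight : List ℕ → List ℕ → ℕ → ℕ → ℕ
joinHeight []      []      _  _  = 0
joinHeight []      (_ ∷ _) _  hB = suc hB
joinHeight (_ ∷ _) []      hA _  = suc hA
joinHeight (a ∷ A) (b ∷ B) hA hB = hA + afterJunction (step (lastOf a A) b) hB

backHeight-append-top : ∀ b B n {h} → lastOf b B ≤ n → BackHeight (b ∷ B) h →
                        BackHeight (b ∷ B ++ [ n ]) (suc h)
backHeight-append-top b B n {h} last≤n bh = begin
  walkBack 0 (descentsFrom b (B ++ [ n ]))              ≡⟨ cong (walkBack 0) (descentsFrom-++ b B n []) ⟩
  walkBack 0 (descentsFrom b B ++ [ step (lastOf b B) n ]) ≡⟨ cong (λ j → walkBack 0 (descentsFrom b B ++ [ j ])) (step-D last≤n) ⟩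
  walkBack 0 (descentsFrom b B ++ [ D ])                ≡⟨ walkBack-snoc-D (descentsFrom b B) ⟩
  walkBack 1 (descentsFrom b B)                         ≡⟨ walkBack-shift 0 (descentsFrom b B) 1 bh ⟩
  just (h + 1)                                          ≡⟨ cong just (+-comm h 1) ⟩
  just (suc h)                                          ∎
  where open ≡-Reasoning

backHeight-join : ∀ A B n {hA hB} → All (_≤ n) A → All (_≤ n) B → BackHeight A hA → BackHeight B hB →
                  BackHeight (A ++ B ++ [ n ]) (joinHeight A B hA hB)
backHeight-join []      []      n _   _   _   _   = refl
backHeight-join []      (b ∷ B) n _   bdB _   bhB = backHeight-append-top b B n (All.lookup bdB (lastOf-∈ b B)) bhB
backHeight-join (a ∷ A) []      n bdA _   bhA _   = backHeight-append-top a A n (All.lookup bdA (lastOf-∈ a A)) bhA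
backHeight-join (a ∷ A) (b ∷ B) n {hA} {hB} bdA bdB bhA bhB = begin
  walkBack 0 (descentsFrom a (A ++ b ∷ B ++ [ n ]))
    ≡⟨ cong (walkBack 0) (descentsFrom-++ a A b (B ++ [ n ])) ⟩
  walkBack 0 (descentsFrom a A ++ j ∷ descentsFrom b (B ++ [ n ]))
    ≡⟨ walkBack-++ 0 (descentsFrom a A) _ ⟩
  (walkBack 0 (descentsFrom b (B ++ [ n ])) >>= stepBack j >>= λ g → walkBack g (descentsFrom a A))
    ≡⟨ cong (λ m → m >>= stepBack j >>= λ g → walkBack g (descentsFrom a A))
            (backHeight-append-top b B n (All.lookup bdB (lastOf-∈ b B)) bhB) ⟩
  (stepBack j (suc hB) >>= λ g → walkBack g (descentsFrom a A))
    ≡⟨ cong (_>>= λ g → walkBack g (descentsFrom a A)) (stepBack-after j) ⟩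
  walkBack (0 + afterJunction j hB) (descentsFrom a A)
    ≡⟨ walkBack-shift 0 (descentsFrom a A) (afterJunction j hB) bhA ⟩
  just (hA + afterJunction j hB)
    ∎
  where
  open ≡-Reasoning
  j : Step
  j = step (lastOf a A) b
  stepBack-after : ∀ j → stepBack j (suc hB) ≡ just (afterJunction j hB)
  stepBack-after U = refl
  stepBack-after D = refl

sorted-bounds : ∀ {L R n} → All (_≤ n) (L ++ R) → DecTree L → DecTree R → All (_≤ n) (s L) × All (_≤ n) (s R)
sorted-bounds {L} bnd tL tR =
  All-resp-↭ (↭-sym (s-↭ tL)) (All.++⁻ˡ L bnd) , All-resp-↭ (↭-sym (s-↭ tR)) (All.++⁻ʳ L bnd)

node-height : ∀ {L R n hA hB} → n ∉ L → All (_≤ n) (L ++ R) → DecTree L → DecTree R →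
              BackHeight (s L) hA → BackHeight (s R) hB →
              BackHeight (s (L ++ n ∷ R)) (joinHeight (s L) (s R) hA hB)
node-height {L} {R} {n} n∉L bnd tL tR bhA bhB rewrite s-unfold L n R n∉L bnd =
  backHeight-join (s L) (s R) n (proj₁ bounds) (proj₂ bounds) bhA bhB
  where
  bounds : All (_≤ n) (s L) × All (_≤ n) (s R)
  bounds = sorted-bounds bnd tL tR

sorted-height : ∀ {π} → DecTree π → ∃ (BackHeight (s π))
sorted-height leaf = 0 , refl
sorted-height (node n n∉L bnd tL tR) with sorted-height tL | sorted-height tR
... | _ , bhA | _ , bhB = _ , node-height n∉L bnd tL tR bhA bhB

junction-zero : ∀ hA hB j → hA + afterJunction j hB ≡ 0 → hA ≡ 0 × hB ≡ 0 × j ≡ U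
junction-zero zero zero U _ = refl , refl , refl

junction-ascent : ∀ j {h} → afterJunction j 0 ≡ suc h → j ≡ D
junction-ascent D _ = refl

data BalancedNode (L R : List ℕ) : Set where
  single : L ≡ [] → R ≡ [] → BalancedNode L R
  double : ∀ {a A b B} → s L ≡ a ∷ A → s R ≡ b ∷ B → BackHeight (a ∷ A) 0 → BackHeight (b ∷ B) 0 →
           step (lastOf a A) b ≡ U → BalancedNode L R

balanced-node : ∀ {L R n} → n ∉ L → All (_≤ n) (L ++ R) → DecTree L → DecTree R →
                BackHeight (s (L ++ n ∷ R)) 0 → BalancedNode L R
balanced-node {L} {R} n∉L bnd tL tR bh with sorted-height tL | sorted-height tR
... | hA , bhA | hB , bhB =
  classify (s L) (s R) hA hB refl refl bhA bhB (backHeight-functional (s (L ++ _ ∷ R)) (node-height n∉L bnd tL tR bhA bhB) bh)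
  where
  classify : ∀ X Y hA hB → s L ≡ X → s R ≡ Y → BackHeight X hA → BackHeight Y hB →
             joinHeight X Y hA hB ≡ 0 → BalancedNode L R
  classify []      []      _  _  eL eR _   _   _   = single (s-empty tL eL) (s-empty tR eR)
  classify (a ∷ A) (b ∷ B) hA hB eL eR bhA bhB v≡0 with junction-zero hA hB (step (lastOf a A) b) v≡0
  ... | refl , refl , j≡U = double eL eR bhA bhB j≡U

-- How a tree node L n R with s(L n R) of positive back-height looks; each
-- case yields a second preimage in another-preimage.
data UnbalancedNode (L R : List ℕ) : Set where
  left-empty  : L ≡ [] → R ≢ [] → UnbalancedNode L R
  right-empty : R ≡ [] → L ≢ [] → UnbalancedNode L R
  left-high   : ∀ {h} → BackHeight (s L) (suc h) → UnbalancedNode L R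
  right-high  : ∀ {h} → BackHeight (s R) (suc h) → UnbalancedNode L R
  ascent      : ∀ {a A b B} → s L ≡ a ∷ A → s R ≡ b ∷ B → BackHeight (a ∷ A) 0 → BackHeight (b ∷ B) 0 →
                step (lastOf a A) b ≡ D → UnbalancedNode L R

unbalanced-node : ∀ {L R n h} → n ∉ L → All (_≤ n) (L ++ R) → DecTree L → DecTree R →
                  BackHeight (s (L ++ n ∷ R)) (suc h) → UnbalancedNode L R
unbalanced-node {L} {R} n∉L bnd tL tR bh with sorted-height tL | sorted-height tR
... | hA , bhA | hB , bhB =
  classify (s L) (s R) hA hB refl refl bhA bhB (backHeight-functional (s (L ++ _ ∷ R)) (node-height n∉L bnd tL tR bhA bhB) bh)
  where
  classify : ∀ X Y hA hB {h} → s L ≡ X → s R ≡ Y → BackHeight X hA → BackHeight Y hB →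
             joinHeight X Y hA hB ≡ suc h → UnbalancedNode L R
  classify []      (_ ∷ _) _        _        eL eR _   _   _ = left-empty (s-empty tL eL) (sorted-nonempty eR)
  classify (_ ∷ _) []      _        _        eL eR _   _   _ = right-empty (s-empty tR eR) (sorted-nonempty eL)
  classify (a ∷ A) (b ∷ B) (suc hA) _        eL _  bhA _   _ = left-high (subst (λ X → BackHeight X (suc hA)) (sym eL) bhA)
  classify (a ∷ A) (b ∷ B) zero     (suc hB) _  eR _   bhB _ = right-high (subst (λ Y → BackHeight Y (suc hB)) (sym eR) bhB)
  classify (a ∷ A) (b ∷ B) zero     zero     eL eR bhA bhB v = ascent eL eR bhA bhB (junction-ascent (step (lastOf a A) b) v)

head-++ : ∀ {xs : List ℕ} ys → xs ≢ [] → head (xs ++ ys) ≡ head xs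
head-++ {[]}    _ xs≢[] = contradiction refl xs≢[]
head-++ {_ ∷ _} _ _     = refl

sorted-head : ∀ {π} → DecTree π → BackHeight (s π) 0 → head (s π) ≡ head π
sorted-head leaf _ = refl
sorted-head (node {L} {R} n n∉L bnd tL tR) bh with balanced-node n∉L bnd tL tR bh
... | single refl refl = cong head (s-unfold [] n [] n∉L bnd)
... | double eL _ bhL _ _ = begin
  head (s (L ++ n ∷ R))       ≡⟨ cong head (s-unfold L n R n∉L bnd) ⟩
  head (s L ++ s R ++ [ n ])  ≡⟨ trans (cong (λ X → head (X ++ s R ++ [ n ])) eL) (cong head (sym eL)) ⟩
  head (s L)                  ≡⟨ sorted-head tL (subst (λ X → BackHeight X 0) (sym eL) bhL) ⟩
  head L                      ≡⟨ sym (head-++ (n ∷ R) (sorted-nonempty eL)) ⟩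
  head (L ++ n ∷ R)           ∎
  where open ≡-Reasoning

s-prefix : ∀ {Y} → DecTree Y → ∀ {r R} → Y ≡ r ∷ R → ∀ X → All (_< r) X → s (X ++ Y) ≡ s X ++ s Y
s-prefix leaf () _ _
s-prefix (node {R₁} {R₂} m m∉R₁ bnd t₁ _) {r} Y≡ X X<r = begin
  s (X ++ R₁ ++ m ∷ R₂)          ≡⟨ cong s (sym (++-assoc X R₁ (m ∷ R₂))) ⟩
  s ((X ++ R₁) ++ m ∷ R₂)         ≡⟨ s-unfold (X ++ R₁) m R₂ m∉XR₁ bndXR ⟩
  s (X ++ R₁) ++ s R₂ ++ [ m ]    ≡⟨ cong (_++ s R₂ ++ [ m ]) (prefix-part R₁ t₁ Y≡) ⟩
  (s X ++ s R₁) ++ s R₂ ++ [ m ]  ≡⟨ ++-assoc (s X) (s R₁) _ ⟩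
  s X ++ s R₁ ++ s R₂ ++ [ m ]    ≡⟨ cong (s X ++_) (sym (s-unfold R₁ m R₂ m∉R₁ bnd)) ⟩
  s X ++ s (R₁ ++ m ∷ R₂)         ∎
  where
  open ≡-Reasoning
  r≤m : r ≤ m
  r≤m = All.lookup (All-insertMiddle R₁ ≤-refl bnd) (subst (r ∈_) (sym Y≡) (here refl))
  X≤m : All (_≤ m) X
  X≤m = All.map (λ x<r → <⇒≤ (<-≤-trans x<r r≤m)) X<r
  m∉XR₁ : m ∉ X ++ R₁
  m∉XR₁ m∈ with ∈-++⁻ X m∈
  ... | inj₁ m∈X  = <-irrefl refl (<-≤-trans (All.lookup X<r m∈X) r≤m)
  ... | inj₂ m∈R₁ = m∉R₁ m∈R₁
  bndXR : All (_≤ m) ((X ++ R₁) ++ R₂)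
  bndXR = All.++⁺ (All.++⁺ X≤m (All.++⁻ˡ R₁ bnd)) (All.++⁻ʳ R₁ bnd)
  prefix-part : ∀ R₁′ → DecTree R₁′ → R₁′ ++ m ∷ R₂ ≡ r ∷ _ → s (X ++ R₁′) ≡ s X ++ s R₁′
  prefix-part []         _  _  = trans (cong s (++-identityʳ X)) (sym (++-identityʳ (s X)))
  prefix-part (r′ ∷ R₁′) t₁ eq = s-prefix t₁ (cong (_∷ R₁′) (∷-injectiveˡ eq)) X X<r

sorted-last : ∀ {π a A} → DecTree π → s π ≡ a ∷ A → All (_≤ lastOf a A) π
sorted-last leaf ()
sorted-last {a = a} {A} (node {L} {R} n n∉L bnd _ _) eq
  rewrite lastOf-snoc a A (s L ++ s R) n (trans (sym eq) (trans (s-unfold L n R n∉L bnd) (sym (++-assoc (s L) (s R) [ n ]))))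
  = All-insertMiddle L ≤-refl bnd

++-split-longer : ∀ (X Y X′ Y′ : List ℕ) → X ++ Y ≡ X′ ++ Y′ → length X < length X′ →
                  ∃₂ λ c Cs → X′ ≡ X ++ c ∷ Cs × Y ≡ c ∷ Cs ++ Y′
++-split-longer []      Y (x′ ∷ X′) Y′ eq _ = x′ , X′ , refl , eq
++-split-longer (x ∷ X) Y (x′ ∷ X′) Y′ eq (s≤s lt) with refl , eq′ ← ∷-injective eq
  with c , Cs , eqX′ , eqY ← ++-split-longer X Y X′ Y′ eq′ lt = c , Cs , cong (x ∷_) eqX′ , eqY

++-injective-length : ∀ (X Y X′ Y′ : List ℕ) → X ++ Y ≡ X′ ++ Y′ → length X ≡ length X′ → X ≡ X′ × Y ≡ Y′
++-injective-length []      Y []        Y′ eq _  = refl , eq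
++-injective-length (x ∷ X) Y (x′ ∷ X′) Y′ eq eqlen with refl , eq′ ← ∷-injective eq
  with eqX , eqY ← ++-injective-length X Y X′ Y′ eq′ (suc-injective eqlen) = cong (x ∷_) eqX , eqY

no-descent-at-zero : ∀ c Cs b B → BackHeight (b ∷ B) 0 → step (lastOf c Cs) b ≡ U → ¬ BackHeight (c ∷ Cs ++ b ∷ B) 0
no-descent-at-zero c Cs b B bhB j≡U bh
  rewrite descentsFrom-++ c Cs b B
        | walkBack-++ 0 (descentsFrom c Cs) (step (lastOf c Cs) b ∷ descentsFrom b B)
        | j≡U | bhB
  with () ← bh

longer-left-impossible : ∀ {a A b B a′ A′ b′ B′} → (a ∷ A) ++ (b ∷ B) ≡ (a′ ∷ A′) ++ (b′ ∷ B′) →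
                         length A < length A′ → BackHeight (b ∷ B) 0 → BackHeight (b′ ∷ B′) 0 →
                         step (lastOf a′ A′) b′ ≡ U → ⊥
longer-left-impossible {a} {A} {b} {B} {a′} {A′} {b′} {B′} eq lt bh bh′ j′
  with c , Cs , eqA′ , eqB ← ++-split-longer (a ∷ A) (b ∷ B) (a′ ∷ A′) (b′ ∷ B′) eq (s≤s lt) =
  no-descent-at-zero c Cs b′ B′ bh′ (trans (cong (λ z → step z b′) (sym last≡)) j′) (subst (λ Z → BackHeight Z 0) eqB bh)
  where
  last≡ : lastOf a′ A′ ≡ lastOf c Cs
  last≡ = trans (cong₂ lastOf (∷-injectiveˡ eqA′) (∷-injectiveʳ eqA′)) (lastOf-++ a A c Cs)

balanced-split-unique : ∀ {a A b B a′ A′ b′ B′} → (a ∷ A) ++ (b ∷ B) ≡ (a′ ∷ A′) ++ (b′ ∷ B′) →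
                        BackHeight (b ∷ B) 0 → BackHeight (b′ ∷ B′) 0 →
                        step (lastOf a A) b ≡ U → step (lastOf a′ A′) b′ ≡ U →
                        a ∷ A ≡ a′ ∷ A′ × b ∷ B ≡ b′ ∷ B′
balanced-split-unique {a} {A} {b} {B} {a′} {A′} {b′} {B′} eq bh bh′ j j′ with <-cmp (length A) (length A′)
... | tri< lt _ _ = ⊥-elim (longer-left-impossible eq lt bh bh′ j′)
... | tri> _ _ gt = ⊥-elim (longer-left-impossible (sym eq) gt bh′ bh j)
... | tri≈ _ eqlen _ = ++-injective-length (a ∷ A) (b ∷ B) (a′ ∷ A′) (b′ ∷ B′) eq (cong suc eqlen)

single≢double : ∀ (n a : ℕ) A b B Z → [ n ] ≢ (a ∷ A) ++ (b ∷ B) ++ Z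
single≢double n a []      b B Z ()
single≢double n a (_ ∷ _) b B Z ()

-- At back-height 0, σ is determined by s(σ): the top entry is the last one
-- of s(σ), the junction of s(L) and s(R) is the unique balanced
-- factorisation, and L and R are recovered recursively.
sorted-unique : ∀ {τ τ′} → DecTree τ → DecTree τ′ → s τ ≡ s τ′ → BackHeight (s τ) 0 → τ ≡ τ′
sorted-unique leaf t′ eq _ = sym (s-empty t′ (sym eq))
sorted-unique t leaf eq _ = s-empty t eq
sorted-unique (node {L} {R} n n∉L bnd tL tR) (node {L′} {R′} n′ n′∉L′ bnd′ tL′ tR′) eq bh
  with balanced-node n∉L bnd tL tR bh | balanced-node n′∉L′ bnd′ tL′ tR′ (subst (λ X → BackHeight X 0) eq bh)
... | single refl refl | single refl refl = cong [_] (∷-injectiveˡ images)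
  where
  images : [ n ] ≡ [ n′ ]
  images = trans (sym (s-unfold [] n [] n∉L bnd)) (trans eq (s-unfold [] n′ [] n′∉L′ bnd′))
... | single refl refl | double {a′} {A′} {b′} {B′} eL′ eR′ _ _ _ = ⊥-elim $
  single≢double n a′ A′ b′ B′ [ n′ ] (trans (trans (sym (s-unfold [] n [] n∉L bnd)) (trans eq (s-unfold L′ n′ R′ n′∉L′ bnd′)))
                                (cong₂ (λ X Y → X ++ Y ++ [ n′ ]) eL′ eR′))
... | double {a} {A} {b} {B} eL eR _ _ _ | single refl refl = ⊥-elim $
  single≢double n′ a A b B [ n ] (trans (trans (sym (s-unfold [] n′ [] n′∉L′ bnd′)) (trans (sym eq) (s-unfold L n R n∉L bnd)))
                                (cong₂ (λ X Y → X ++ Y ++ [ n ]) eL eR))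
... | double {a} {A} {b} {B} eL eR bhL bhR j | double {a′} {A′} {b′} {B′} eL′ eR′ bhL′ bhR′ j′ =
  cong₂ (λ X Y → X ++ Y) sameL (cong₂ _∷_ (proj₂ prefix-and-top) sameR)
  where
  images : (a ∷ A ++ b ∷ B) ++ [ n ] ≡ (a′ ∷ A′ ++ b′ ∷ B′) ++ [ n′ ]
  images = begin
    (a ∷ A ++ b ∷ B) ++ [ n ]        ≡⟨ ++-assoc (a ∷ A) (b ∷ B) [ n ] ⟩
    (a ∷ A) ++ (b ∷ B) ++ [ n ]  ≡⟨ cong₂ (λ X Y → X ++ Y ++ [ n ]) (sym eL) (sym eR) ⟩
    s L ++ s R ++ [ n ]          ≡⟨ trans (sym (s-unfold L n R n∉L bnd)) (trans eq (s-unfold L′ n′ R′ n′∉L′ bnd′)) ⟩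
    s L′ ++ s R′ ++ [ n′ ]       ≡⟨ cong₂ (λ X Y → X ++ Y ++ [ n′ ]) eL′ eR′ ⟩
    (a′ ∷ A′) ++ (b′ ∷ B′) ++ [ n′ ] ≡⟨ sym (++-assoc (a′ ∷ A′) (b′ ∷ B′) [ n′ ]) ⟩
    (a′ ∷ A′ ++ b′ ∷ B′) ++ [ n′ ]   ∎
    where open ≡-Reasoning
  prefix-and-top : (a ∷ A ++ b ∷ B) ≡ (a′ ∷ A′ ++ b′ ∷ B′) × n ≡ n′
  prefix-and-top = ∷ʳ-injective (a ∷ A ++ b ∷ B) (a′ ∷ A′ ++ b′ ∷ B′) images
  parts : a ∷ A ≡ a′ ∷ A′ × b ∷ B ≡ b′ ∷ B′
  parts = balanced-split-unique (proj₁ prefix-and-top) bhR bhR′ j j′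
  sameL : L ≡ L′
  sameL = sorted-unique tL tL′ (trans eL (trans (proj₁ parts) (sym eL′))) (subst (λ X → BackHeight X 0) (sym eL) bhL)
  sameR : R ≡ R′
  sameR = sorted-unique tR tR′ (trans eR (trans (proj₂ parts) (sym eR′))) (subst (λ X → BackHeight X 0) (sym eR) bhR)

AllPairs-resp-⊆ : ∀ {R : ℕ → ℕ → Set} {xs ys} → xs ⊆ ys → AllPairs R ys → AllPairs R xs
AllPairs-resp-⊆ []         []       = []
AllPairs-resp-⊆ (_ ∷ʳ sub) (_ ∷ ps) = AllPairs-resp-⊆ sub ps
AllPairs-resp-⊆ (refl ∷ sub) (p ∷ ps) = Sublist.All-resp-⊆ sub p ∷ AllPairs-resp-⊆ sub ps

unique-⊆ : ∀ {xs ys : List ℕ} → xs ⊆ ys → Unique ys → Unique xs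
unique-⊆ = AllPairs-resp-⊆

unique-↭ : ∀ {xs ys : List ℕ} → xs ↭ ys → Unique xs → Unique ys
unique-↭ p = PermutationSetoid.Unique-resp-↭ (setoid ℕ) (↭⇒↭ₛ p)

unique-left : ∀ L {R : List ℕ} → Unique (L ++ R) → Unique L
unique-left L = unique-⊆ (Sublist.++⁺ʳ _ ⊆-refl)

unique-disjoint : ∀ L {R : List ℕ} {y} → Unique (L ++ R) → y ∈ L → y ∉ R
unique-disjoint (x ∷ L) (x∉ ∷ _) (here refl) y∈R = All.lookup (All.++⁻ʳ L x∉) y∈R refl
unique-disjoint (x ∷ L) (_ ∷ u)  (there y∈L) y∈R = unique-disjoint L u y∈L y∈R

unique-middle : ∀ L {n R} → Unique (L ++ n ∷ R) → n ∉ L ++ R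
unique-middle L {n} {R} u = Unique[x∷xs]⇒x∉xs (unique-↭ (shift n L R) u)

isPerm-unique : ∀ {n π} → IsPerm n π → Unique π
isPerm-unique {n} p = unique-↭ (↭-sym p) (applyUpTo⁺₁ suc n (λ i<j _ → <⇒≢ i<j ∘ suc-injective))

isPerm-length : ∀ {n π} → IsPerm n π → length π ≡ n
isPerm-length {n} p = trans (↭-length p) (length-applyUpTo suc n)

AnotherPreimage : List ℕ → Set
AnotherPreimage σ = ∃ λ σ′ → σ′ ↭ σ × s σ′ ≡ s σ × σ′ ≢ σ

another-by-regrouping : ∀ {L R} n L₂ R₂ → n ∉ L ++ R → All (_≤ n) (L ++ R) → L₂ ++ R₂ ↭ L ++ R →
                        s L₂ ++ s R₂ ≡ s L ++ s R → L₂ ++ n ∷ R₂ ≢ L ++ n ∷ R → AnotherPreimage (L ++ n ∷ R)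
another-by-regrouping {L} {R} n L₂ R₂ n∉ bnd p same-images differ =
  L₂ ++ n ∷ R₂ , ↭-trans (shift n L₂ R₂) (↭-trans (prep n p) (↭-sym (shift n L R))) , images , differ
  where
  open ≡-Reasoning
  images : s (L₂ ++ n ∷ R₂) ≡ s (L ++ n ∷ R)
  images = begin
    s (L₂ ++ n ∷ R₂)        ≡⟨ s-unfold L₂ n R₂ (n∉ ∘ ∈-resp-↭ p ∘ ∈-++⁺ˡ) (All-resp-↭ (↭-sym p) bnd) ⟩
    s L₂ ++ s R₂ ++ [ n ]   ≡⟨ sym (++-assoc (s L₂) (s R₂) [ n ]) ⟩
    (s L₂ ++ s R₂) ++ [ n ] ≡⟨ cong (_++ [ n ]) same-images ⟩
    (s L ++ s R) ++ [ n ]   ≡⟨ ++-assoc (s L) (s R) [ n ] ⟩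
    s L ++ s R ++ [ n ]     ≡⟨ sym (s-unfold L n R (n∉ ∘ ∈-++⁺ˡ) bnd) ⟩
    s (L ++ n ∷ R)          ∎

-- If s(L) and s(R) meet at an ascent, every entry of L lies below the first
-- entry of R, so L ++ R sorts to s(L) ++ s(R).
ascent-is-ordered : ∀ {L R n a A b B} → Unique (L ++ n ∷ R) → DecTree L → DecTree R →
                    s L ≡ a ∷ A → s R ≡ b ∷ B → BackHeight (b ∷ B) 0 → step (lastOf a A) b ≡ D →
                    s (L ++ R) ≡ s L ++ s R
ascent-is-ordered {L} {[]}    _ _ _  _  eR _   _ = contradiction refl (sorted-nonempty eR)
ascent-is-ordered {L} {r ∷ R} {b = b} u tL tR eL eR bhR j = s-prefix tR refl L (All.tabulate below-r)
  where
  b≡r : b ≡ r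
  b≡r = just-injective (trans (cong head (sym eR)) (sorted-head tR (subst (λ Y → BackHeight Y 0) (sym eR) bhR)))
  below-r : ∀ {y} → y ∈ L → y < r
  below-r y∈L = ≤∧≢⇒< (≤-trans (All.lookup (sorted-last tL eL) y∈L) (subst (_ ≤_) b≡r (step-D⁻ j)))
                      (λ y≡r → unique-disjoint L u y∈L (there (here y≡r)))

insert≢cons : ∀ {n : ℕ} xs ys zs → xs ≢ [] → n ∉ xs → xs ++ n ∷ ys ≢ n ∷ zs
insert≢cons []       _ _ xs≢[] _  _  = xs≢[] refl
insert≢cons (x ∷ xs) _ _ _     n∉ eq = n∉ (here (sym (∷-injectiveˡ eq)))

-- At positive back-height, s(σ) has a second preimage: move the maximum to
-- the other end when one side is empty, recurse into a side of positive
-- height, or put the maximum in front when the sides meet at an ascent.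
another-preimage : ∀ {σ h} → DecTree σ → Unique σ → BackHeight (s σ) (suc h) → AnotherPreimage σ
another-preimage (node {L} {R} n n∉L bnd tL tR) u bh with unbalanced-node n∉L bnd tL tR bh
... | left-empty refl R≢[] =
  another-by-regrouping {[]} {R} n R [] n∉R bnd (↭-reflexive (++-identityʳ R)) (++-identityʳ (s R))
    (insert≢cons {n} R [] R R≢[] n∉R)
  where
  n∉R : n ∉ R
  n∉R = unique-middle [] u
... | right-empty refl L≢[] =
  another-by-regrouping n [] (L ++ []) n∉L+ bnd ↭-refl (trans (cong s (++-identityʳ L)) (sym (++-identityʳ (s L))))
    (insert≢cons {n} L [] (L ++ []) L≢[] n∉L ∘ sym)
  where
  n∉L+ : n ∉ L ++ []
  n∉L+ = unique-middle L u
... | left-high bhL with L₃ , L₃↭L , sL₃ , L₃≢L ← another-preimage tL (unique-left L u) bhL =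
  another-by-regrouping n L₃ R (unique-middle L u) bnd (++⁺ʳ R L₃↭L) (cong (_++ s R) sL₃)
    (L₃≢L ∘ ++-cancelʳ (n ∷ R) L₃ L)
... | right-high bhR with R₃ , R₃↭R , sR₃ , R₃≢R ← another-preimage tR (unique-⊆ (Sublist.++⁺ˡ L (n ∷ʳ ⊆-refl)) u) bhR =
  another-by-regrouping n L R₃ (unique-middle L u) bnd (++⁺ˡ L R₃↭R) (cong (s L ++_) sR₃)
    (R₃≢R ∘ ∷-injectiveʳ ∘ ++-cancelˡ L (n ∷ R₃) (n ∷ R))
... | ascent eL eR _ bhR j =
  another-by-regrouping n [] (L ++ R) (unique-middle L u) bnd ↭-refl (ascent-is-ordered u tL tR eL eR bhR j)
    (insert≢cons {n} L R (L ++ R) (sorted-nonempty eL) n∉L ∘ sym)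

-- Every entry between a and a later smaller entry c lies strictly between
-- them in value.  For distinct entries this is avoidance of 231 and 312.
Sandwiched : List ℕ → Set
Sandwiched π = ∀ {a b c} → (a ∷ b ∷ c ∷ []) ⊆ π → c < a → c < b × b < a

sandwiched-⊆ : ∀ {xs ys} → xs ⊆ ys → Sandwiched ys → Sandwiched xs
sandwiched-⊆ xs⊆ys sw sub = sw (⊆-trans sub xs⊆ys)

p231 p312 : List ℕ
p231 = 2 ∷ 3 ∷ 1 ∷ []
p312 = 3 ∷ 1 ∷ 2 ∷ []

private
  both : ∀ {A B : Set} → A → B → A ⇔ B
  both a b = mk⇔ (λ _ → b) (λ _ → a)

  neither : ∀ {A B : Set} → ¬ A → ¬ B → A ⇔ B
  neither ¬a ¬b = mk⇔ (λ a → contradiction a ¬a) (λ b → contradiction b ¬b)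

  irrefl : ∀ {x} → ¬ x < x
  irrefl = <-irrefl refl

contains231 : ∀ {π a b c} → (a ∷ b ∷ c ∷ []) ⊆ π → c < a → a < b → Contains π p231
contains231 {a = a} {b} {c} sub c<a a<b = a ∷ b ∷ c ∷ [] , sub , refl , table
  where
  c<b : c < b
  c<b = <-trans c<a a<b
  table : (i j : Fin 3) → (lookup (a ∷ b ∷ c ∷ []) i < lookup (a ∷ b ∷ c ∷ []) j) ⇔ (lookup p231 (cast refl i) < lookup p231 (cast refl j))
  table #0               #0               = neither irrefl irrefl
  table #0               (fsuc #0)        = both a<b (s≤s (s≤s (s≤s z≤n)))
  table #0               (fsuc (fsuc #0)) = neither (<-asym c<a) λ { (s≤s ()) }
  table (fsuc #0)        #0               = neither (<-asym a<b) λ { (s≤s (s≤s ())) }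
  table (fsuc #0)        (fsuc #0)        = neither irrefl irrefl
  table (fsuc #0)        (fsuc (fsuc #0)) = neither (<-asym c<b) λ { (s≤s ()) }
  table (fsuc (fsuc #0)) #0               = both c<a (s≤s (s≤s z≤n))
  table (fsuc (fsuc #0)) (fsuc #0)        = both c<b (s≤s (s≤s z≤n))
  table (fsuc (fsuc #0)) (fsuc (fsuc #0)) = neither irrefl irrefl

contains312 : ∀ {π a b c} → (a ∷ b ∷ c ∷ []) ⊆ π → b < c → c < a → Contains π p312
contains312 {a = a} {b} {c} sub b<c c<a = a ∷ b ∷ c ∷ [] , sub , refl , table
  where
  b<a : b < a
  b<a = <-trans b<c c<a
  table : (i j : Fin 3) → (lookup (a ∷ b ∷ c ∷ []) i < lookup (a ∷ b ∷ c ∷ []) j) ⇔ (lookup p312 (cast refl i) < lookup p312 (cast refl j))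
  table #0               #0               = neither irrefl irrefl
  table #0               (fsuc #0)        = neither (<-asym b<a) λ { (s≤s ()) }
  table #0               (fsuc (fsuc #0)) = neither (<-asym c<a) λ { (s≤s (s≤s ())) }
  table (fsuc #0)        #0               = both b<a (s≤s (s≤s z≤n))
  table (fsuc #0)        (fsuc #0)        = neither irrefl irrefl
  table (fsuc #0)        (fsuc (fsuc #0)) = both b<c (s≤s (s≤s z≤n))
  table (fsuc (fsuc #0)) #0               = both c<a (s≤s (s≤s (s≤s z≤n)))
  table (fsuc (fsuc #0)) (fsuc #0)        = neither (<-asym b<c) λ { (s≤s ()) }
  table (fsuc (fsuc #0)) (fsuc (fsuc #0)) = neither irrefl irrefl

sandwiched⇒avoids231 : ∀ {π} → Sandwiched π → Avoids π p231
sandwiched⇒avoids231 sw (a ∷ b ∷ c ∷ [] , sub , _ , order) = <-asym a<b (proj₂ (sw sub c<a))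
  where
  c<a : c < a
  c<a = Equivalence.from (order (fsuc (fsuc #0)) #0) (s≤s (s≤s z≤n))
  a<b : a < b
  a<b = Equivalence.from (order #0 (fsuc #0)) (s≤s (s≤s (s≤s z≤n)))

sandwiched⇒avoids312 : ∀ {π} → Sandwiched π → Avoids π p312
sandwiched⇒avoids312 sw (a ∷ b ∷ c ∷ [] , sub , _ , order) = <-asym b<c (proj₁ (sw sub c<a))
  where
  c<a : c < a
  c<a = Equivalence.from (order (fsuc (fsuc #0)) #0) (s≤s (s≤s (s≤s z≤n)))
  b<c : b < c
  b<c = Equivalence.from (order (fsuc #0) (fsuc (fsuc #0))) (s≤s (s≤s z≤n))

avoids⇒sandwiched : ∀ {π} → Unique π → Avoids π p231 → Avoids π p312 → Sandwiched π
avoids⇒sandwiched u av231 av312 {a} {b} {c} sub c<a with unique-⊆ sub u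
... | (a≢b ∷ _) ∷ (b≢c ∷ _) ∷ _ with <-cmp b c | <-cmp b a
... | tri< b<c _ _ | _            = contradiction (contains312 sub b<c c<a) av312
... | tri≈ _ b≡c _ | _            = contradiction b≡c b≢c
... | tri> _ _ c<b | tri< b<a _ _ = c<b , b<a
... | tri> _ _ _   | tri≈ _ b≡a _ = contradiction (sym b≡a) a≢b
... | tri> _ _ _   | tri> _ _ a<b = contradiction (contains231 sub c<a a<b) av231

block : ℕ → ℕ → List ℕ
block o zero    = []
block o (suc c) = o + suc c ∷ block o c

-- The layered permutation of a word: consecutive decreasing blocks of
-- increasing values, a new block starting after each D.  The current block
-- has size c and starts above o.
layeredFrom : ℕ → ℕ → List Step → List ℕ
layeredFrom o c []      = block o c
layeredFrom o c (U ∷ w) = layeredFrom o (suc c) w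
layeredFrom o c (D ∷ w) = block o c ++ layeredFrom (o + c) 1 w

layered : List Step → List ℕ
layered = layeredFrom 0 1

block-range : ∀ o c {x} → x ∈ block o c → o < x × x ≤ o + c
block-range o (suc c) (here refl) = m<m+n o (s≤s z≤n) , ≤-refl
block-range o (suc c) (there x∈) with block-range o c x∈
... | o<x , x≤o+c = o<x , ≤-trans x≤o+c (+-monoʳ-≤ o (n≤1+n c))

layeredFrom-above : ∀ w o c {x} → x ∈ layeredFrom o c w → o < x
layeredFrom-above []      o c x∈ = proj₁ (block-range o c x∈)
layeredFrom-above (U ∷ w) o c x∈ = layeredFrom-above w o (suc c) x∈
layeredFrom-above (D ∷ w) o c x∈ with ∈-++⁻ (block o c) x∈
... | inj₁ x∈B = proj₁ (block-range o c x∈B)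
... | inj₂ x∈W = ≤-<-trans (m≤m+n o c) (layeredFrom-above w (o + c) 1 x∈W)

Decreasing : List ℕ → Set
Decreasing = AllPairs (λ a b → b < a)

block-decreasing : ∀ o c → Decreasing (block o c)
block-decreasing o zero    = []
block-decreasing o (suc c) =
  All.tabulate (λ x∈ → ≤-<-trans (proj₂ (block-range o c x∈)) (+-monoʳ-< o (n<1+n c))) ∷ block-decreasing o c

sandwiched-decreasing : ∀ {Y} → Decreasing Y → Sandwiched Y
sandwiched-decreasing dec sub _ with AllPairs-resp-⊆ sub dec
... | (b<a ∷ _) ∷ (c<b ∷ _) ∷ _ = c<b , b<a

⊆-++-split : ∀ (Y : List ℕ) {R xs} → xs ⊆ Y ++ R → ∃₂ λ xs₁ xs₂ → xs ≡ xs₁ ++ xs₂ × xs₁ ⊆ Y × xs₂ ⊆ R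
⊆-++-split []      sub = [] , _ , refl , [] , sub
⊆-++-split (y ∷ Y) (.y ∷ʳ sub) with xs₁ , xs₂ , refl , sub₁ , sub₂ ← ⊆-++-split Y sub =
  xs₁ , xs₂ , refl , y ∷ʳ sub₁ , sub₂
⊆-++-split (y ∷ Y) (refl ∷ sub) with xs₁ , xs₂ , refl , sub₁ , sub₂ ← ⊆-++-split Y sub =
  y ∷ xs₁ , xs₂ , refl , refl ∷ sub₁ , sub₂

sandwiched-++ : ∀ Y R → Decreasing Y → (∀ {y r} → y ∈ Y → r ∈ R → y < r) → Sandwiched R → Sandwiched (Y ++ R)
sandwiched-++ Y R dec Y<R swR {a} {b} {c} sub c<a with ⊆-++-split Y sub
... | []              , _     , refl , _    , sub₂ = swR sub₂ c<a
... | _ ∷ []          , _     , refl , sub₁ , sub₂ =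
  ⊥-elim (<-asym c<a (Y<R (∈-resp-⊆ sub₁ (here refl)) (∈-resp-⊆ sub₂ (there (here refl)))))
... | _ ∷ _ ∷ []      , _     , refl , sub₁ , sub₂ =
  ⊥-elim (<-asym c<a (Y<R (∈-resp-⊆ sub₁ (here refl)) (∈-resp-⊆ sub₂ (here refl))))
... | _ ∷ _ ∷ _ ∷ []  , []    , refl , sub₁ , _    = sandwiched-decreasing dec sub₁ c<a

sandwiched-layered : ∀ w o c → Sandwiched (layeredFrom o c w)
sandwiched-layered []      o c = sandwiched-decreasing (block-decreasing o c)
sandwiched-layered (U ∷ w) o c = sandwiched-layered w o (suc c)
sandwiched-layered (D ∷ w) o c =
  sandwiched-++ (block o c) (layeredFrom (o + c) 1 w) (block-decreasing o c)
    (λ y∈ r∈ → ≤-<-trans (proj₂ (block-range o c y∈)) (layeredFrom-above w (o + c) 1 r∈))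
    (sandwiched-layered w (o + c) 1)

descents-block : ∀ o c → descentsFrom (o + suc c) (block o c) ≡ replicate c U
descents-block o zero    = refl
descents-block o (suc c) = cong₂ _∷_ (step-U (+-monoʳ-< o (n<1+n (suc c)))) (descents-block o c)

layeredFrom-nonempty : ∀ w o c → ∃₂ λ r rs → layeredFrom o (suc c) w ≡ r ∷ rs
layeredFrom-nonempty []      o c = _ , _ , refl
layeredFrom-nonempty (U ∷ w) o c = layeredFrom-nonempty w o (suc c)
layeredFrom-nonempty (D ∷ w) o c = _ , _ , refl

replicate-snoc : ∀ c (w : List Step) → replicate (suc c) U ++ w ≡ replicate c U ++ U ∷ w
replicate-snoc zero    w = refl
replicate-snoc (suc c) w = cong (U ∷_) (replicate-snoc c w)

descents-layeredFrom : ∀ w o c → descents (layeredFrom o (suc c) w) ≡ replicate c U ++ w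
descents-layeredFrom []      o c = trans (descents-block o c) (sym (++-identityʳ _))
descents-layeredFrom (U ∷ w) o c = trans (descents-layeredFrom w o (suc c)) (replicate-snoc c w)
descents-layeredFrom (D ∷ w) o c with layeredFrom-nonempty w (o + suc c) 0 | descents-layeredFrom w (o + suc c) 0
... | r , rs , eq | rest rewrite eq =
  trans (descentsFrom-++ (o + suc c) (block o c) r rs)
        (cong₂ _++_ (descents-block o c) (cong₂ _∷_ (step-D (<⇒≤ last<r)) rest))
  where
  r∈ : r ∈ layeredFrom (o + suc c) 1 w
  r∈ = subst (r ∈_) (sym eq) (here refl)
  last≤ : lastOf (o + suc c) (block o c) ≤ o + suc c
  last≤ with lastOf-∈ (o + suc c) (block o c)
  ... | here eq′   = ≤-reflexive eq′
  ... | there x∈ = ≤-trans (proj₂ (block-range o c x∈)) (+-monoʳ-≤ o (n≤1+n c))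
  last<r : lastOf (o + suc c) (block o c) < r
  last<r = ≤-<-trans last≤ (layeredFrom-above w (o + suc c) 1 r∈)

descents-layered : ∀ w → descents (layered w) ≡ w
descents-layered w = descents-layeredFrom w 0 0

interval : ℕ → ℕ → List ℕ
interval o zero    = []
interval o (suc c) = suc o ∷ interval (suc o) c

interval-++ : ∀ o a b → interval o (a + b) ≡ interval o a ++ interval (o + a) b
interval-++ o zero    b rewrite +-identityʳ o = refl
interval-++ o (suc a) b rewrite interval-++ (suc o) a b | +-suc o a = refl

interval-snoc : ∀ o c → interval o (suc c) ≡ interval o c ++ [ o + suc c ]
interval-snoc o c = trans (cong (interval o) (+-comm 1 c)) (trans (interval-++ o c 1) (cong (λ z → interval o c ++ [ z ]) (sym (+-suc o c))))

block↭interval : ∀ o c → block o c ↭ interval o c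
block↭interval o zero    = ↭-refl
block↭interval o (suc c) = subst (block o (suc c) ↭_) (sym (interval-snoc o c))
  (↭-trans (prep (o + suc c) (block↭interval o c)) (∷↭∷ʳ (o + suc c) (interval o c)))

layeredFrom↭interval : ∀ w o c → layeredFrom o c w ↭ interval o (c + length w)
layeredFrom↭interval []      o c rewrite +-identityʳ c = block↭interval o c
layeredFrom↭interval (U ∷ w) o c rewrite +-suc c (length w) = layeredFrom↭interval w o (suc c)
layeredFrom↭interval (D ∷ w) o c rewrite interval-++ o c (suc (length w)) =
  ++⁺ (block↭interval o c) (layeredFrom↭interval w (o + c) 1)

interval≡applyUpTo : ∀ n o (f : ℕ → ℕ) → (∀ i → f i ≡ suc (o + i)) → interval o n ≡ applyUpTo f n
interval≡applyUpTo zero    o f f≗ = refl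
interval≡applyUpTo (suc n) o f f≗ = cong₂ _∷_ (sym (trans (f≗ 0) (cong suc (+-identityʳ o))))
  (interval≡applyUpTo n (suc o) (λ i → f (suc i)) (λ i → trans (f≗ (suc i)) (cong suc (+-suc o i))))

layered-isPerm : ∀ w → IsPerm (suc (length w)) (layered w)
layered-isPerm w = subst (layered w ↭_) (interval≡applyUpTo (suc (length w)) 0 suc (λ _ → refl)) (layeredFrom↭interval w 0 1)

length-snoc : ∀ {A : Set} (v : List A) x → length (v ++ [ x ]) ≡ suc (length v)
length-snoc v x = trans (length-++ v) (+-comm (length v) 1)

init-shorter : ∀ {A : Set} (v : List A) {x f} → length (v ++ [ x ]) ≤ suc f → length v ≤ f
init-shorter v {x} le = ≤-pred (subst (_≤ _) (length-snoc v x) le)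

prefix-shorter : ∀ {A : Set} (u : List A) {w f} → length (u ++ w) ≤ f → length u ≤ f
prefix-shorter u {w} le = ≤-trans (≤-trans (m≤m+n (length u) (length w)) (≤-reflexive (sym (length-++ u)))) le

-- A back-walk that starts at c + 1 and ends at most at c crosses down from
-- c + 1 to c: reading from the right, the first such crossing is a U whose
-- right part is balanced.
first-down-crossing : ∀ f v c {g} → length v ≤ f → walkBack (suc c) v ≡ just g → g ≤ c →
                      ∃₂ λ v₁ v₂ → v ≡ v₁ ++ U ∷ v₂ × walkBack 0 v₂ ≡ just 0 × walkBack c v₁ ≡ just g
first-down-crossing f v c le bh g≤c with initLast v
first-down-crossing f .[] c le refl g≤c | [] = contradiction g≤c (<-irrefl refl ∘ s≤s)
first-down-crossing f .(v ++ [ U ]) c le bh g≤c | v ∷ʳ′ U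
  rewrite walkBack-++ (suc c) v [ U ] = v , [] , refl , refl , bh
first-down-crossing zero .(v ++ [ D ]) c le bh g≤c | v ∷ʳ′ D
  with () ← subst (_≤ 0) (length-snoc v D) le
first-down-crossing (suc f) .(v ++ [ D ]) c le bh g≤c | v ∷ʳ′ D
  rewrite walkBack-++ (suc c) v [ D ]
  with u₁ , u₂ , refl , bh₂ , bh₁ ← first-down-crossing f v (suc c) (init-shorter v le) bh (≤-trans g≤c (n≤1+n c))
  with t₁ , t₂ , refl , bh₂′ , bh₁′ ← first-down-crossing f u₁ c (prefix-shorter u₁ (init-shorter (u₁ ++ U ∷ u₂) le)) bh₁ g≤c =
  t₁ , t₂ ++ U ∷ u₂ ++ [ D ] , reassoc , balanced , bh₁′
  where
  reassoc : ((t₁ ++ U ∷ t₂) ++ U ∷ u₂) ++ [ D ] ≡ t₁ ++ U ∷ (t₂ ++ U ∷ u₂ ++ [ D ])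
  reassoc = trans (++-assoc (t₁ ++ U ∷ t₂) (U ∷ u₂) [ D ]) (++-assoc t₁ (U ∷ t₂) _)
  balanced : walkBack 0 (t₂ ++ U ∷ u₂ ++ [ D ]) ≡ just 0
  balanced rewrite walkBack-++ 0 t₂ (U ∷ u₂ ++ [ D ]) | walkBack-snoc-D u₂ | walkBack-shift 0 u₂ 1 bh₂ = bh₂′

factorise-at-descent : ∀ x xs v₁ v₂ → descentsFrom x xs ≡ v₁ ++ U ∷ v₂ →
  ∃₂ λ a A → ∃₂ λ b B → x ∷ xs ≡ (a ∷ A) ++ (b ∷ B) ×
    descentsFrom a A ≡ v₁ × step (lastOf a A) b ≡ U × descentsFrom b B ≡ v₂
factorise-at-descent x (y ∷ ys) []       v₂ eq with j , rest ← ∷-injective eq =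
  x , [] , y , ys , refl , refl , j , rest
factorise-at-descent x (y ∷ ys) (_ ∷ v₁) v₂ eq with j , rest ← ∷-injective eq
  with a , A , b , B , refl , eqA , jAB , eqB ← factorise-at-descent y ys v₁ v₂ rest =
  x , a ∷ A , b , B , refl , cong₂ _∷_ j eqA , jAB , eqB

balanced-factorisation : ∀ x xs → walkBack 1 (descentsFrom x xs) ≡ just 0 →
  ∃₂ λ a A → ∃₂ λ b B → x ∷ xs ≡ (a ∷ A) ++ (b ∷ B) ×
    BackHeight (a ∷ A) 0 × BackHeight (b ∷ B) 0 × step (lastOf a A) b ≡ U
balanced-factorisation x xs bh
  with v₁ , v₂ , eqv , bh₂ , bh₁ ← first-down-crossing _ (descentsFrom x xs) 0 ≤-refl bh z≤n
  with a , A , b , B , eq , eqA , j , eqB ← factorise-at-descent x xs v₁ v₂ eqv =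
  a , A , b , B , eq , subst (λ w → walkBack 0 w ≡ just 0) (sym eqA) bh₁ ,
  subst (λ w → walkBack 0 w ≡ just 0) (sym eqB) bh₂ , j

final-ascent : ∀ x xs n → BackHeight (x ∷ xs ++ [ n ]) 0 →
               lastOf x xs ≤ n × walkBack 1 (descentsFrom x xs) ≡ just 0
final-ascent x xs n bh
  rewrite descentsFrom-++ x xs n [] | walkBack-++ 0 (descentsFrom x xs) [ step (lastOf x xs) n ]
  with step (lastOf x xs) n in j
... | D = step-D⁻ j , bh

earlier-or-last : ∀ p P {y} → y ∈ p ∷ P → y ≡ lastOf p P ⊎ (y ∷ lastOf p P ∷ []) ⊆ p ∷ P
earlier-or-last p []      (here y≡p)  = inj₁ y≡p
earlier-or-last p (q ∷ Q) (here refl) = inj₂ (refl ∷ from∈ (lastOf-∈ q Q))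
earlier-or-last p (q ∷ Q) (there y∈) with earlier-or-last q Q y∈
... | inj₁ y≡last = inj₁ y≡last
... | inj₂ sub    = inj₂ (p ∷ʳ sub)

below-final : ∀ x xs n → Sandwiched (x ∷ xs ++ [ n ]) → Unique (x ∷ xs ++ [ n ]) → lastOf x xs ≤ n →
              All (_< n) (x ∷ xs)
below-final x xs n sw u last≤n = All.tabulate below
  where
  n∉ : n ∉ x ∷ xs
  n∉ n∈ = unique-disjoint (x ∷ xs) u n∈ (here refl)
  last<n : lastOf x xs < n
  last<n = ≤∧≢⇒< last≤n (λ last≡n → n∉ (subst (_∈ x ∷ xs) last≡n (lastOf-∈ x xs)))
  below : ∀ {y} → y ∈ x ∷ xs → y < n
  below y∈ with earlier-or-last x xs y∈
  ... | inj₁ refl = last<n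
  ... | inj₂ sub  = ≤∧≢⇒< (≮⇒≥ (λ n<y → <-asym last<n (proj₁ (sw (Sublist.++⁺ sub (refl ∷ [])) n<y))))
                          (λ y≡n → n∉ (subst (_∈ x ∷ xs) y≡n y∈))

s-single : ∀ x → s [ x ] ≡ [ x ]
s-single x = s-unfold [] x [] (λ ()) []

preimage-join : ∀ τA τB {A B n} → s τA ≡ A → s τB ≡ B → All (_< n) (A ++ B) → s (τA ++ n ∷ τB) ≡ A ++ B ++ [ n ]
preimage-join τA τB {A} {B} {n} sτA sτB below = begin
  s (τA ++ n ∷ τB)        ≡⟨ s-unfold τA n τB (λ n∈ → <-irrefl refl (All.lookup belowA n∈)) (All.map <⇒≤ (All.++⁺ belowA belowB)) ⟩
  s τA ++ s τB ++ [ n ]   ≡⟨ cong₂ (λ X Y → X ++ Y ++ [ n ]) sτA sτB ⟩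
  A ++ B ++ [ n ]         ∎
  where
  open ≡-Reasoning
  belowA : All (_< n) τA
  belowA = All-resp-↭ (subst (_↭ τA) sτA (s-↭ (decTree τA))) (All.++⁻ˡ A below)
  belowB : All (_< n) τB
  belowB = All-resp-↭ (subst (_↭ τB) sτB (s-↭ (decTree τB))) (All.++⁻ʳ A below)

-- A sandwiched list of distinct entries with back-height 0 is in the image
-- of s: remove its final maximum, split the rest at the balanced descent, and
-- join the preimages of the two parts by the maximum.
sorted-preimage : ∀ f π → length π ≤ f → Sandwiched π → Unique π → BackHeight π 0 → ∃ λ τ → s τ ≡ π
sorted-preimage _       []       _  _  _ _  = [] , refl
sorted-preimage (suc f) (x ∷ xs) le sw u bh with initLast xs
... | [] = [ x ] , s-single x
... | xs′ ∷ʳ′ n with final-ascent x xs′ n bh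
...   | last≤n , bh′ with balanced-factorisation x xs′ bh′
...     | a , A , b , B , eq , bhA , bhB , _ = τA ++ n ∷ τB , trans (preimage-join τA τB sτA sτB below) (sym π≡)
  where
  π≡ : x ∷ xs′ ++ [ n ] ≡ (a ∷ A) ++ (b ∷ B) ++ [ n ]
  π≡ = trans (cong (_++ [ n ]) eq) (++-assoc (a ∷ A) (b ∷ B) [ n ])
  below : All (_< n) ((a ∷ A) ++ (b ∷ B))
  below = subst (All (_< n)) eq (below-final x xs′ n sw u last≤n)
  sw′ : Sandwiched ((a ∷ A) ++ (b ∷ B) ++ [ n ])
  sw′ = subst Sandwiched π≡ sw
  u′ : Unique ((a ∷ A) ++ (b ∷ B) ++ [ n ])
  u′ = subst Unique π≡ u
  short : length ((a ∷ A) ++ (b ∷ B)) ≤ f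
  short = subst (λ ys → length ys ≤ f) eq (init-shorter (x ∷ xs′) le)
  A⊆ : (a ∷ A) ⊆ (a ∷ A) ++ (b ∷ B) ++ [ n ]
  A⊆ = Sublist.++⁺ʳ _ ⊆-refl
  B⊆ : (b ∷ B) ⊆ (a ∷ A) ++ (b ∷ B) ++ [ n ]
  B⊆ = Sublist.++⁺ˡ (a ∷ A) (Sublist.++⁺ʳ [ n ] ⊆-refl)
  preA : ∃ λ τ → s τ ≡ a ∷ A
  preA = sorted-preimage f (a ∷ A) (prefix-shorter (a ∷ A) short) (sandwiched-⊆ A⊆ sw′) (unique-⊆ A⊆ u′) bhA
  preB : ∃ λ τ → s τ ≡ b ∷ B
  preB = sorted-preimage f (b ∷ B) (≤-trans (m≤n+m (length (b ∷ B)) (length (a ∷ A))) (≤-trans (≤-reflexive (sym (length-++ (a ∷ A)))) short))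
           (sandwiched-⊆ B⊆ sw′) (unique-⊆ B⊆ u′) bhB
  τA τB : List ℕ
  τA = proj₁ preA
  τB = proj₁ preB
  sτA : s τA ≡ a ∷ A
  sτA = proj₂ preA
  sτB : s τB ≡ b ∷ B
  sτB = proj₂ preB

dropLast : List Step → List Step
dropLast []          = []
dropLast (x ∷ [])    = []
dropLast (x ∷ y ∷ w) = x ∷ dropLast (y ∷ w)

dropLast-snoc : ∀ w x → dropLast (w ++ [ x ]) ≡ w
dropLast-snoc []          x = refl
dropLast-snoc (y ∷ [])    x = refl
dropLast-snoc (y ∷ z ∷ w) x = cong (y ∷_) (dropLast-snoc (z ∷ w) x)

trailingUsFrom : ℕ → List Step → ℕ
trailingUsFrom k []      = k
trailingUsFrom k (U ∷ w) = trailingUsFrom (suc k) w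
trailingUsFrom k (D ∷ w) = trailingUsFrom 0 w

trailingUs : List Step → ℕ
trailingUs = trailingUsFrom 0

trailingUs-after-D : ∀ k w v → trailingUsFrom k (w ++ D ∷ v) ≡ trailingUs v
trailingUs-after-D k []      v = refl
trailingUs-after-D k (U ∷ w) v = trailingUs-after-D (suc k) w v
trailingUs-after-D k (D ∷ w) v = trailingUs-after-D 0 w v

trailingUs-replicate : ∀ k j → trailingUsFrom k (replicate j U) ≡ k + j
trailingUs-replicate k zero    = sym (+-identityʳ k)
trailingUs-replicate k (suc j) = trans (trailingUs-replicate (suc k) j) (sym (+-suc k j))

replicate-U-snoc : ∀ c → replicate (suc c) U ≡ replicate c U ++ [ U ]
replicate-U-snoc c = trans (sym (++-identityʳ _)) (replicate-snoc c [])

descents-decreasing : ∀ n Z → Decreasing (n ∷ Z) → descentsFrom n Z ≡ replicate (length Z) U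
descents-decreasing n []      _                = refl
descents-decreasing n (z ∷ Z) ((z<n ∷ _) ∷ dec) = cong₂ _∷_ (step-U z<n) (descents-decreasing z Z dec)

Junction : List ℕ → List ℕ → Set
Junction (x ∷ X) (z ∷ Z) = lastOf x X ≤ z
Junction _       _       = ⊤

descents-after-top : ∀ x X n Z → All (_< n) (x ∷ X) → Decreasing (n ∷ Z) →
                     descents (x ∷ X ++ n ∷ Z) ≡ descentsFrom x X ++ D ∷ replicate (length Z) U
descents-after-top x X n Z X<n dec =
  trans (descentsFrom-++ x X n Z)
        (cong₂ (λ j v → descentsFrom x X ++ j ∷ v) (step-D (<⇒≤ (All.lookup X<n (lastOf-∈ x X)))) (descents-decreasing n Z dec))

trailing-after-top : ∀ x X n Z → All (_< n) (x ∷ X) → Decreasing (n ∷ Z) →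
                     trailingUs (descents (x ∷ X ++ n ∷ Z)) ≡ length Z
trailing-after-top x X n Z X<n dec =
  trans (cong trailingUs (descents-after-top x X n Z X<n dec))
        (trans (trailingUs-after-D 0 (descentsFrom x X) _) (trailingUs-replicate 0 (length Z)))

descents-remove-top : ∀ X n Z → All (_< n) X → Decreasing (n ∷ Z) → Junction X Z →
  trailingUs (descents (X ++ n ∷ Z)) ≡ length Z × dropLast (descents (X ++ n ∷ Z)) ≡ descents (X ++ Z)
descents-remove-top [] n [] _ _ _ = refl , refl
descents-remove-top [] n (z ∷ Z) _ dec@(_ ∷ decZ) _ =
  trans (cong trailingUs down) (trailingUs-replicate 0 _) ,
  trans (cong dropLast (trans down (replicate-U-snoc (length Z))))
        (trans (dropLast-snoc _ U) (sym (descents-decreasing z Z decZ)))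
  where
  down : descentsFrom n (z ∷ Z) ≡ replicate (suc (length Z)) U
  down = descents-decreasing n (z ∷ Z) dec
descents-remove-top (x ∷ X) n [] X<n dec _ =
  trailing-after-top x X n [] X<n dec ,
  (begin
    dropLast (descents (x ∷ X ++ [ n ]))          ≡⟨ cong dropLast (descents-after-top x X n [] X<n dec) ⟩
    dropLast (descentsFrom x X ++ [ D ])          ≡⟨ dropLast-snoc (descentsFrom x X) D ⟩
    descentsFrom x X                              ≡⟨ cong (descentsFrom x) (sym (++-identityʳ X)) ⟩
    descents (x ∷ X ++ [])                        ∎)
  where open ≡-Reasoning
descents-remove-top (x ∷ X) n (z ∷ Z) X<n dec@(_ ∷ decZ) last≤z =
  trailing-after-top x X n (z ∷ Z) X<n dec ,
  (begin
    dropLast (descents (x ∷ X ++ n ∷ z ∷ Z))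
      ≡⟨ cong dropLast (descents-after-top x X n (z ∷ Z) X<n dec) ⟩
    dropLast (descentsFrom x X ++ D ∷ replicate (suc (length Z)) U)
      ≡⟨ cong (λ v → dropLast (descentsFrom x X ++ D ∷ v)) (replicate-U-snoc (length Z)) ⟩
    dropLast (descentsFrom x X ++ D ∷ replicate (length Z) U ++ [ U ])
      ≡⟨ cong dropLast (sym (++-assoc (descentsFrom x X) (D ∷ replicate (length Z) U) [ U ])) ⟩
    dropLast ((descentsFrom x X ++ D ∷ replicate (length Z) U) ++ [ U ])
      ≡⟨ dropLast-snoc _ U ⟩
    descentsFrom x X ++ D ∷ replicate (length Z) U
      ≡⟨ cong₂ (λ j v → descentsFrom x X ++ j ∷ v) (sym (step-D last≤z)) (sym (descents-decreasing z Z decZ)) ⟩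
    descentsFrom x X ++ step (lastOf x X) z ∷ descentsFrom z Z
      ≡⟨ sym (descentsFrom-++ x X z Z) ⟩
    descents (x ∷ X ++ z ∷ Z)
      ∎)
  where open ≡-Reasoning

decreasing-after-top : ∀ n Z → Sandwiched (n ∷ Z) → All (_< n) Z → Decreasing (n ∷ Z)
decreasing-after-top n []      _  []          = [] ∷ []
decreasing-after-top n (z ∷ Z) sw (z<n ∷ Z<n) =
  (z<n ∷ Z<n) ∷ decreasing-after-top z Z (sandwiched-⊆ (n ∷ʳ ⊆-refl) sw) (All.tabulate Z<z)
  where
  Z<z : ∀ {y} → y ∈ Z → y < z
  Z<z y∈ = proj₁ (sw (refl ∷ refl ∷ from∈ y∈) (All.lookup Z<n y∈))

sandwiched-junction : ∀ X n Z → Sandwiched (X ++ n ∷ Z) → All (_< n) X → Junction X Z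
sandwiched-junction []      _ _       _  _   = tt
sandwiched-junction (x ∷ X) n []      _  _   = tt
sandwiched-junction (x ∷ X) n (z ∷ Z) sw X<n =
  ≮⇒≥ λ z<last → <-asym (All.lookup X<n (lastOf-∈ x X)) (proj₂ (sw triple z<last))
  where
  triple : (lastOf x X ∷ n ∷ z ∷ []) ⊆ x ∷ X ++ n ∷ z ∷ Z
  triple = Sublist.++⁺ (from∈ (lastOf-∈ x X)) (refl ∷ refl ∷ Sublist.[]⊆-universal Z)

record TopSplit (m : ℕ) (π : List ℕ) : Set where
  field
    left right      : List ℕ
    shape           : π ≡ left ++ suc m ∷ right
    rest-isPerm     : IsPerm m (left ++ right)
    rest-sandwiched : Sandwiched (left ++ right)
    trailing        : trailingUs (descents π) ≡ length right
    dropped         : dropLast (descents π) ≡ descents (left ++ right)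

topSplit : ∀ m π → IsPerm (suc m) π → Sandwiched π → TopSplit m π
topSplit m π p sw with ∈-∃++ (∈-resp-↭ (↭-sym p) (∈-applyUpTo⁺ suc (≤-refl {suc m})))
... | X , Z , refl = record
  { left = X ; right = Z ; shape = refl
  ; rest-isPerm = rest-isPerm
  ; rest-sandwiched = sandwiched-⊆ rest⊆ sw
  ; trailing = proj₁ words
  ; dropped = proj₂ words
  }
  where
  n : ℕ
  n = suc m
  rest⊆ : X ++ Z ⊆ X ++ n ∷ Z
  rest⊆ = Sublist.++⁺ ⊆-refl (n ∷ʳ ⊆-refl)
  at-most-n : ∀ {y} → y ∈ X ++ n ∷ Z → y ≤ n
  at-most-n y∈ with _ , i<n , refl ← ∈-applyUpTo⁻ suc (∈-resp-↭ p y∈) = i<n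
  below : All (_< n) (X ++ Z)
  below = All.tabulate λ y∈ → ≤∧≢⇒< (at-most-n (∈-resp-⊆ rest⊆ y∈))
                                      (λ y≡n → unique-middle X (isPerm-unique p) (subst (_∈ X ++ Z) y≡n y∈))
  rest-isPerm : IsPerm m (X ++ Z)
  rest-isPerm = subst (X ++ Z ↭_) (++-identityʳ _)
    (drop-mid X (applyUpTo suc m) (subst (X ++ n ∷ Z ↭_) (sym (applyUpTo-∷ʳ suc m)) p))
  words : trailingUs (descents (X ++ n ∷ Z)) ≡ length Z × dropLast (descents (X ++ n ∷ Z)) ≡ descents (X ++ Z)
  words = descents-remove-top X n Z (All.++⁻ˡ X below)
            (decreasing-after-top n Z (sandwiched-⊆ (Sublist.++⁺ˡ X ⊆-refl) sw) (All.++⁻ʳ X below))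
            (sandwiched-junction X n Z sw (All.++⁻ˡ X below))

-- Sandwiched permutations of [m] are determined by their descent words: the
-- number of trailing U's locates the maximum, and dropping the last letter
-- gives the descent word of the rest.
descents-injective : ∀ m {π₁ π₂} → IsPerm m π₁ → IsPerm m π₂ → Sandwiched π₁ → Sandwiched π₂ →
                     descents π₁ ≡ descents π₂ → π₁ ≡ π₂
descents-injective zero    p₁ p₂ _   _   _  = trans (↭-empty-inv p₁) (sym (↭-empty-inv p₂))
descents-injective (suc m) {π₁} {π₂} p₁ p₂ sw₁ sw₂ eq =
  trans T₁.shape (trans (cong₂ (λ X Z → X ++ suc m ∷ Z) (proj₁ parts) (proj₂ parts)) (sym T₂.shape))
  where
  module T₁ = TopSplit (topSplit m π₁ p₁ sw₁)
  module T₂ = TopSplit (topSplit m π₂ p₂ sw₂)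
  same-right-length : length T₁.right ≡ length T₂.right
  same-right-length = trans (sym T₁.trailing) (trans (cong trailingUs eq) T₂.trailing)
  same-rest : T₁.left ++ T₁.right ≡ T₂.left ++ T₂.right
  same-rest = descents-injective m T₁.rest-isPerm T₂.rest-isPerm T₁.rest-sandwiched T₂.rest-sandwiched
                (trans (sym T₁.dropped) (trans (cong dropLast eq) T₂.dropped))
  rest-length : ∀ X Z → IsPerm m (X ++ Z) → length X + length Z ≡ m
  rest-length X Z p = trans (sym (length-++ X)) (isPerm-length p)
  same-left-length : length T₁.left ≡ length T₂.left
  same-left-length = +-cancelʳ-≡ (length T₁.right) _ _
    (trans (rest-length T₁.left T₁.right T₁.rest-isPerm)
           (trans (sym (rest-length T₂.left T₂.right T₂.rest-isPerm)) (cong (length T₂.left +_) (sym same-right-length))))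
  parts : T₁.left ≡ T₂.left × T₁.right ≡ T₂.right
  parts = ++-injective-length T₁.left T₁.right T₂.left T₂.right same-rest same-left-length

walk⇒walkBack : ∀ w h h′ → walk h w ≡ just h′ → walkBack h′ w ≡ just h
walk⇒walkBack []      h       h′ eq = cong just (sym (just-injective eq))
walk⇒walkBack (U ∷ w) h       h′ eq rewrite walk⇒walkBack w (suc h) h′ eq = refl
walk⇒walkBack (D ∷ w) (suc h) h′ eq rewrite walk⇒walkBack w h h′ eq = refl

walkBack⇒walk : ∀ w h h′ → walkBack h′ w ≡ just h → walk h w ≡ just h′
walkBack⇒walk []      h h′ eq = cong just (sym (just-injective eq))
walkBack⇒walk (x ∷ w) h h′ eq with walkBack h′ w in eqw
walkBack⇒walk (U ∷ w) h h′ refl | just (suc g) = walkBack⇒walk w (suc h) h′ eqw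
walkBack⇒walk (D ∷ w) h h′ refl | just g       = walkBack⇒walk w g h′ eqw

-- A uniquely sorted permutation has back-height 0: it is s(σ), and a positive
-- back-height would give σ a rival preimage.
uniquely-sorted⇒balanced : ∀ {n π} → UniquelySorted n π → BackHeight π 0
uniquely-sorted⇒balanced (σ , σ-perm , sσ≡π , only-σ) with sorted-height (decTree σ)
... | zero , bh  = subst (λ π → BackHeight π 0) sσ≡π bh
... | suc _ , bh with σ′ , σ′↭σ , sσ′≡sσ , σ′≢σ ← another-preimage (decTree σ) (isPerm-unique σ-perm) bh =
  contradiction (only-σ σ′ (↭-trans σ′↭σ σ-perm) (trans sσ′≡sσ sσ≡π)) σ′≢σ

descents-isDyck : ∀ k π → U231-312 (2 * k + 1) π → IsDyck k (descents π)
descents-isDyck k π (π-perm , uniquely , _ , _) = length-descents π (isPerm-length π-perm) ,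
  walkBack⇒walk (descents π) 0 0 (uniquely-sorted⇒balanced uniquely)
  where
  length-descents : ∀ π → length π ≡ 2 * k + 1 → length (descents π) ≡ 2 * k
  length-descents []       eq = contradiction (trans eq (+-comm (2 * k) 1)) λ ()
  length-descents (x ∷ xs) eq = trans (length-descentsFrom x xs) (suc-injective (trans eq (+-comm (2 * k) 1)))

-- The layered permutation of a Dyck path lies in 𝒰_{2k+1}(231,312): it is
-- sandwiched with back-height 0, so it has a preimage, which is unique.
layered-uniquely-sorted : ∀ k p → IsDyck k p → U231-312 (2 * k + 1) (layered p)
layered-uniquely-sorted k p (length-p , walk-p) =
  π-perm , (σ , σ-perm , sσ≡π , only-σ) , sandwiched⇒avoids231 sw , sandwiched⇒avoids312 sw
  where
  π : List ℕ
  π = layered p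
  π-perm : IsPerm (2 * k + 1) π
  π-perm = subst (λ n → IsPerm n π) (trans (cong suc length-p) (+-comm 1 (2 * k))) (layered-isPerm p)
  sw : Sandwiched π
  sw = sandwiched-layered p 0 1
  balanced : BackHeight π 0
  balanced = subst (λ w → walkBack 0 w ≡ just 0) (sym (descents-layered p)) (walk⇒walkBack p 0 0 walk-p)
  preimage : ∃ λ σ → s σ ≡ π
  preimage = sorted-preimage (length π) π ≤-refl sw (isPerm-unique π-perm) balanced
  σ : List ℕ
  σ = proj₁ preimage
  sσ≡π : s σ ≡ π
  sσ≡π = proj₂ preimage
  σ-perm : IsPerm (2 * k + 1) σ
  σ-perm = ↭-trans (↭-sym (subst (_↭ σ) sσ≡π (s-↭ (decTree σ)))) π-perm
  only-σ : (τ : List ℕ) → IsPerm (2 * k + 1) τ → s τ ≡ π → τ ≡ σ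
  only-σ τ _ sτ≡π = sym (sorted-unique (decTree σ) (decTree τ) (trans sσ≡π (sym sτ≡π))
                                      (subst (λ π → BackHeight π 0) (sym sσ≡π) balanced))

uniquelySorted↔dyck : ∀ k → Bijection (𝒰-setoid (2 * k + 1)) (𝒟-setoid k)
uniquelySorted↔dyck k = record
  { to        = λ { (π , π∈) → descents π , descents-isDyck k π π∈ }
  ; cong      = λ {x} {y} → cong descents
  ; bijective = (λ {x} {y} → injective {x} {y}) , surjective
  }
  where
  injective : ∀ {x y : Σ (List ℕ) (U231-312 (2 * k + 1))} → descents (proj₁ x) ≡ descents (proj₁ y) → proj₁ x ≡ proj₁ y
  injective {_ , p₁ , _ , a₁ , b₁} {_ , p₂ , _ , a₂ , b₂} =
    descents-injective (2 * k + 1) p₁ p₂ (avoids⇒sandwiched (isPerm-unique p₁) a₁ b₁) (avoids⇒sandwiched (isPerm-unique p₂) a₂ b₂)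
  surjective : ∀ (y : Σ (List Step) (IsDyck k)) → Σ (Σ (List ℕ) (U231-312 (2 * k + 1))) λ x →
               ∀ {z} → proj₁ z ≡ proj₁ x → descents (proj₁ z) ≡ proj₁ y
  surjective (p , p-dyck) = (layered p , layered-uniquely-sorted k p p-dyck) , λ eq → trans (cong descents eq) (descents-layered p)

-- ballot h m: the number of words of length m whose walk from height h stays
-- nonnegative and ends at 0.
ballot : ℕ → ℕ → ℕ
ballot zero    zero    = 1
ballot (suc h) zero    = 0
ballot zero    (suc m) = ballot 1 m
ballot (suc h) (suc m) = ballot (suc (suc h)) m + ballot h m

rank : ∀ h m (w : List Step) → length w ≡ m → walk h w ≡ just 0 → Fin (ballot h m)
rank zero    zero    []      _ _  = #0
rank (suc h) zero    []      _ ()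
rank zero    (suc m) (U ∷ w) l e  = rank 1 m w (suc-injective l) e
rank (suc h) (suc m) (U ∷ w) l e  = rank (suc (suc h)) m w (suc-injective l) e ↑ˡ ballot h m
rank (suc h) (suc m) (D ∷ w) l e  = ballot (suc (suc h)) m ↑ʳ rank h m w (suc-injective l) e

rank-irrelevant : ∀ h m w l l′ e e′ → rank h m w l e ≡ rank h m w l′ e′
rank-irrelevant zero    zero    []      _ _ _ _  = refl
rank-irrelevant (suc h) zero    []      _ _ () _
rank-irrelevant zero    (suc m) (U ∷ w) _ _ e e′ = rank-irrelevant 1 m w _ _ e e′
rank-irrelevant (suc h) (suc m) (U ∷ w) _ _ e e′ = cong (_↑ˡ ballot h m) (rank-irrelevant (suc (suc h)) m w _ _ e e′)
rank-irrelevant (suc h) (suc m) (D ∷ w) _ _ e e′ = cong (ballot (suc (suc h)) m ↑ʳ_) (rank-irrelevant h m w _ _ e e′)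

unrank : ∀ h m → Fin (ballot h m) → List Step
unrank zero    zero    _ = []
unrank zero    (suc m) i = U ∷ unrank 1 m i
unrank (suc h) (suc m) i with splitAt (ballot (suc (suc h)) m) i
... | inj₁ j = U ∷ unrank (suc (suc h)) m j
... | inj₂ j = D ∷ unrank h m j

length-unrank : ∀ h m i → length (unrank h m i) ≡ m
length-unrank zero    zero    _ = refl
length-unrank zero    (suc m) i = cong suc (length-unrank 1 m i)
length-unrank (suc h) (suc m) i with splitAt (ballot (suc (suc h)) m) i
... | inj₁ j = cong suc (length-unrank (suc (suc h)) m j)
... | inj₂ j = cong suc (length-unrank h m j)

walk-unrank : ∀ h m i → walk h (unrank h m i) ≡ just 0
walk-unrank zero    zero    _ = refl
walk-unrank zero    (suc m) i = walk-unrank 1 m i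
walk-unrank (suc h) (suc m) i with splitAt (ballot (suc (suc h)) m) i
... | inj₁ j = walk-unrank (suc (suc h)) m j
... | inj₂ j = walk-unrank h m j

unrank-rank : ∀ h m w l e → unrank h m (rank h m w l e) ≡ w
unrank-rank zero    zero    []      _ _  = refl
unrank-rank (suc h) zero    []      _ ()
unrank-rank zero    (suc m) (U ∷ w) l e  = cong (U ∷_) (unrank-rank 1 m w _ e)
unrank-rank (suc h) (suc m) (U ∷ w) l e
  rewrite splitAt-↑ˡ (ballot (suc (suc h)) m) (rank (suc (suc h)) m w (suc-injective l) e) (ballot h m)
  = cong (U ∷_) (unrank-rank (suc (suc h)) m w _ e)
unrank-rank (suc h) (suc m) (D ∷ w) l e
  rewrite splitAt-↑ʳ (ballot (suc (suc h)) m) (ballot h m) (rank h m w (suc-injective l) e)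
  = cong (D ∷_) (unrank-rank h m w _ e)

rejoin : ∀ m n (i : Fin (m + n)) {r} → splitAt m i ≡ r → join m n r ≡ i
rejoin m n i refl = join-splitAt m n i

rank-unrank : ∀ h m i l e → rank h m (unrank h m i) l e ≡ i
rank-unrank zero    zero    #0 _ _ = refl
rank-unrank zero    (suc m) i  _ e = rank-unrank 1 m i _ e
rank-unrank (suc h) (suc m) i  _ e with splitAt (ballot (suc (suc h)) m) i in eq
... | inj₁ j = trans (cong (_↑ˡ ballot h m) (rank-unrank (suc (suc h)) m j _ e)) (rejoin _ _ i eq)
... | inj₂ j = trans (cong (ballot (suc (suc h)) m ↑ʳ_) (rank-unrank h m j _ e)) (rejoin _ _ i eq)

dyck↔ballot : ∀ k → Bijection (𝒟-setoid k) (Fin-setoid (ballot 0 (2 * k)))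
dyck↔ballot k = record
  { to        = λ { (p , l , e) → rank 0 (2 * k) p l e }
  ; cong      = λ { {p , l , e} {.p , l′ , e′} refl → rank-irrelevant 0 (2 * k) p l l′ e e′ }
  ; bijective = (λ { {p , l , e} {p′ , l′ , e′} eq →
                   trans (sym (unrank-rank 0 (2 * k) p l e)) (trans (cong (unrank 0 (2 * k)) eq) (unrank-rank 0 (2 * k) p′ l′ e′)) })
              , (λ i → (unrank 0 (2 * k) i , length-unrank 0 (2 * k) i , walk-unrank 0 (2 * k) i) ,
                   λ { {p , l , e} refl → rank-unrank 0 (2 * k) i l e })
  }

binom : ℕ → ℕ → ℕ
binom n       zero    = 1
binom zero    (suc k) = 0
binom (suc n) (suc k) = binom n k + binom n (suc k)

binom≡C : ∀ n k → binom n k ≡ n C k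
binom≡C n       zero    = refl
binom≡C zero    (suc k) = sym (k>n⇒nCk≡0 {0} {suc k} (s≤s z≤n))
binom≡C (suc n) (suc k) = trans (cong₂ _+_ (binom≡C n k) (binom≡C n (suc k))) (nCk+nC[k+1]≡[n+1]C[k+1] n k)

binomBelow : ℕ → ℕ → ℕ
binomBelow n zero    = 0
binomBelow n (suc w) = binom n w

binom-pascal : ∀ n w → binom (suc n) w ≡ binomBelow n w + binom n w
binom-pascal n zero    = refl
binom-pascal n (suc w) = refl

ballot-unreachable : ∀ h m → m < h → ballot h m ≡ 0
ballot-unreachable (suc h) zero    _        = refl
ballot-unreachable (suc h) (suc m) (s≤s m<h) =
  cong₂ _+_ (ballot-unreachable (suc (suc h)) m (≤-trans m<h (≤-trans (n≤1+n h) (n≤1+n (suc h))))) (ballot-unreachable h m m<h)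

ballot-straight-down : ∀ h → ballot h h ≡ 1
ballot-straight-down zero    = refl
ballot-straight-down (suc h) = cong₂ _+_ (ballot-unreachable (suc (suc h)) h (n≤1+n (suc h))) (ballot-straight-down h)

binom-middle-symmetric : ∀ w → binom (suc (2 * w)) (suc w) ≡ binom (suc (2 * w)) w
binom-middle-symmetric w = begin
  binom (suc (2 * w)) (suc w)     ≡⟨ binom≡C (suc (2 * w)) (suc w) ⟩
  suc (2 * w) C suc w             ≡⟨ cong (suc (2 * w) C_) (sym complement) ⟩
  suc (2 * w) C (suc (2 * w) ∸ w) ≡⟨ sym (nCk≡nC[n∸k] w≤) ⟩
  suc (2 * w) C w                 ≡⟨ sym (binom≡C (suc (2 * w)) w) ⟩
  binom (suc (2 * w)) w           ∎
  where
  open ≡-Reasoning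
  split : suc (2 * w) ≡ w + suc w
  split = solve 1 (λ w → con 1 :+ con 2 :* w := w :+ (con 1 :+ w)) refl w
  complement : suc (2 * w) ∸ w ≡ suc w
  complement = trans (cong (_∸ w) split) (m+n∸m≡n w (suc w))
  w≤ : w ≤ suc (2 * w)
  w≤ = ≤-trans (m≤m+n w (suc w)) (≤-reflexive (sym split))

-- The reflection principle: ballot h (h + 2w) = C(h + 2w, w) - C(h + 2w, w - 1),
-- proved by induction on w and h along the ballot recursion.
ballot-reflection : ∀ w h → ballot h (h + 2 * w) + binomBelow (h + 2 * w) w ≡ binom (h + 2 * w) w
ballot-reflection-step : ∀ w h → ballot h (suc (suc h + 2 * w)) + binom (suc (suc h + 2 * w)) w ≡ binom (suc (suc h + 2 * w)) (suc w)
ballot-reflection zero h =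
  subst (λ m → ballot h m + binomBelow m 0 ≡ binom m 0) (sym (+-identityʳ h)) (trans (+-identityʳ _) (ballot-straight-down h))
ballot-reflection (suc w) h =
  subst (λ m → ballot h m + binomBelow m (suc w) ≡ binom m (suc w)) (sym (index w)) (ballot-reflection-step w h)
  where
  index : ∀ w → h + 2 * suc w ≡ suc (suc h + 2 * w)
  index w = solve 2 (λ h w → h :+ con 2 :* (con 1 :+ w) := con 1 :+ ((con 1 :+ h) :+ con 2 :* w)) refl h w
ballot-reflection-step w zero = begin
  ballot 1 M + binom (suc M) w            ≡⟨ cong (ballot 1 M +_) (binom-pascal M w) ⟩
  ballot 1 M + (binomBelow M w + binom M w) ≡⟨ sym (+-assoc (ballot 1 M) _ _) ⟩
  (ballot 1 M + binomBelow M w) + binom M w ≡⟨ cong (_+ binom M w) (ballot-reflection w 1) ⟩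
  binom M w + binom M w                   ≡⟨ cong (binom M w +_) (sym (binom-middle-symmetric w)) ⟩
  binom M w + binom M (suc w)             ∎
  where
  open ≡-Reasoning
  M : ℕ
  M = suc (2 * w)
ballot-reflection-step w (suc h) = begin
  (up + down) + binom (suc M) w    ≡⟨ cong ((up + down) +_) (binom-pascal M w) ⟩
  (up + down) + (lower + middle)     ≡⟨ solve 4 (λ a b e c → (a :+ b) :+ (e :+ c) := (a :+ e) :+ (b :+ c)) refl up down lower middle ⟩
  (up + lower) + (down + middle)     ≡⟨ cong₂ _+_ (ballot-reflection w (suc (suc h))) (ballot-reflection-step w h) ⟩
  middle + binom M (suc w)           ∎
  where
  open ≡-Reasoning
  M up down lower middle : ℕ
  M = suc (suc h + 2 * w)
  up = ballot (suc (suc h)) M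
  down = ballot h M
  lower = binomBelow M w
  middle = binom M w

binom-1 : ∀ n → binom n 1 ≡ n
binom-1 zero    = refl
binom-1 (suc n) = cong suc (binom-1 n)

binom-absorption : ∀ n k → suc k * binom (suc n) (suc k) ≡ suc n * binom n k
binom-absorption zero    zero    = refl
binom-absorption zero    (suc k) = trans (*-zeroʳ (suc (suc k))) (sym (+-identityʳ _))
binom-absorption (suc n) zero    = trans (+-identityʳ _) (trans (cong suc (binom-1 (suc n))) (sym (*-identityʳ (suc (suc n)))))
binom-absorption (suc n) (suc j) = begin
  suc (suc j) * (x + y)
    ≡⟨ solve 3 (λ j x y → (con 2 :+ j) :* (x :+ y) := ((con 1 :+ j) :* x :+ x) :+ (con 2 :+ j) :* y) refl j x y ⟩
  (suc j * x + x) + suc (suc j) * y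
    ≡⟨ cong₂ (λ u v → (u + x) + v) (binom-absorption n j) (binom-absorption n (suc j)) ⟩
  (suc n * binom n j + x) + suc n * binom n (suc j)
    ≡⟨ solve 4 (λ n p q x → ((con 1 :+ n) :* p :+ x) :+ (con 1 :+ n) :* q := (con 1 :+ n) :* (p :+ q) :+ x) refl n (binom n j) (binom n (suc j)) x ⟩
  suc n * x + x
    ≡⟨ solve 2 (λ n x → (con 1 :+ n) :* x :+ x := (con 2 :+ n) :* x) refl n x ⟩
  suc (suc n) * x
    ∎
  where
  open ≡-Reasoning
  x y : ℕ
  x = binom (suc n) (suc j)
  y = binom (suc n) (suc (suc j))

binom-ratio : ∀ n j → suc j * binom n (suc j) + j * binom n j ≡ n * binom n j
binom-ratio zero    zero    = refl
binom-ratio zero    (suc j) = cong₂ _+_ (*-zeroʳ (suc (suc j))) (*-zeroʳ (suc j))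
binom-ratio (suc m) zero    = trans (+-identityʳ _) (binom-absorption m 0)
binom-ratio (suc m) (suc i) = begin
  suc (suc i) * binom (suc m) (suc (suc i)) + suc i * binom (suc m) (suc i)
    ≡⟨ cong₂ _+_ (binom-absorption m (suc i)) (binom-absorption m i) ⟩
  suc m * binom m (suc i) + suc m * binom m i
    ≡⟨ solve 3 (λ m p q → (con 1 :+ m) :* p :+ (con 1 :+ m) :* q := (con 1 :+ m) :* (q :+ p)) refl m (binom m (suc i)) (binom m i) ⟩
  suc m * binom (suc m) (suc i)
    ∎
  where open ≡-Reasoning

-- C(2k, k) = (k + 1) ballot 0 (2k), from the reflection principle at height 0.
central-binom≡ballot : ∀ k → binom (2 * k) k ≡ suc k * ballot 0 (2 * k)
central-binom≡ballot zero    = refl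
central-binom≡ballot (suc j) = sym (+-cancelʳ-≡ (suc j * Ck) _ _ counted)
  where
  n Ck Cj Bk : ℕ
  n = 2 * suc j
  Ck = binom n (suc j)
  Cj = binom n j
  Bk = ballot 0 n
  reflection : Bk + Cj ≡ Ck
  reflection = ballot-reflection (suc j) 0
  ratio : suc j * Ck ≡ suc (suc j) * Cj
  ratio = +-cancelʳ-≡ (j * Cj) _ _
    (trans (binom-ratio n j)
           (trans (cong (_* Cj) (solve 1 (λ j → con 2 :* (con 1 :+ j) := (con 2 :+ j) :+ j) refl j))
                  (*-distribʳ-+ Cj (suc (suc j)) j)))
  counted : suc (suc j) * Bk + suc j * Ck ≡ Ck + suc j * Ck
  counted = begin
    suc (suc j) * Bk + suc j * Ck         ≡⟨ cong (suc (suc j) * Bk +_) ratio ⟩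
    suc (suc j) * Bk + suc (suc j) * Cj  ≡⟨ sym (*-distribˡ-+ (suc (suc j)) Bk Cj) ⟩
    suc (suc j) * (Bk + Cj)              ≡⟨ cong (suc (suc j) *_) reflection ⟩
    suc (suc j) * Ck                     ≡⟨ solve 2 (λ j c → (con 2 :+ j) :* c := c :+ (con 1 :+ j) :* c) refl j Ck ⟩
    Ck + suc j * Ck                       ∎
    where open ≡-Reasoning

ballot≡catalan : ∀ k → ballot 0 (2 * k) ≡ catalan k
ballot≡catalan k = sym (begin
  catalan k                         ≡⟨ cong (_/ suc k) (sym (binom≡C (2 * k) k)) ⟩
  binom (2 * k) k / suc k           ≡⟨ cong (_/ suc k) (central-binom≡ballot k) ⟩
  suc k * ballot 0 (2 * k) / suc k  ≡⟨ cong (_/ suc k) (*-comm (suc k) (ballot 0 (2 * k))) ⟩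
  ballot 0 (2 * k) * suc k / suc k  ≡⟨ m*n/n≡m (ballot 0 (2 * k)) (suc k) ⟩
  ballot 0 (2 * k)                  ∎)
  where open ≡-Reasoning

lemma3p3 : (k : ℕ) →
    Bijection (𝒰-setoid (2 * k + 1)) (𝒟-setoid k) ×
    Bijection (𝒰-setoid (2 * k + 1)) (Fin-setoid (catalan k))
lemma3p3 k = uniquelySorted↔dyck k , bijection (uniquelySorted↔dyck k) dyck↔catalan
  where
  dyck↔catalan : Bijection (𝒟-setoid k) (Fin-setoid (catalan k))
  dyck↔catalan = subst (λ m → Bijection (𝒟-setoid k) (Fin-setoid m)) (ballot≡catalan k) (dyck↔ballot k)
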